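{- For all integers $n,k$ with $1\le k\le n$: (i) $B_{n,k}(\widehat T_1,\ldots,\widehat T_{n-k+1})=\binom{n-1}{k-1}\widehat P_{n-k,n}$; (ii) $A_{n,k}(\widehat T_1,\ldots,\widehat T_{n-k+1})=\binom nk\widehat P_{n-k,-k}$.
   Context: $\mathbb{K}$ is a field of characteristic zero. Partial Bell polynomials: $B_{0,0}=1$, $B_{n,0}=0$ ($n\ge1$), $B_{n,k}=0$ ($k>n$), and for $1\le k\le n$, $B_{n,k}=\sum\frac{n!}{\prod_ir_i!(i!)^{r_i}}\prod_iX_i^{r_i}$ over non-negative integers with $\sum r_i=k$, $\sum ir_i=n$. $A_{n,k}\in\mathbb{K}[X_1^{ -1},X_1,X_2,\ldots]$ is the unique lower triangular family with $A_{0,0}=1$, $A_{n,0}=0$ ($n\ge1$) and $\sum_{j=k}^nA_{n,j}B_{j,k}=\delta_{nk}$. Potential polynomials: $\widehat P_{n,r}:=\sum_{j=0}^n r(r-1)\cdots(r-j+1)X_0^{r-j}B_{n,j}$ for $n\ge0$, $r\in\mathbb{Z}$ (Laurent in $X_0$). Tree polynomials: $\widehat T_n:=\sum_{k=0}^{n-1}n(n-1)\cdots(n-k+1)X_0^{n-k}B_{n-1,k}$ $(n\ge1)$, a polynomial in $X_0,\ldots,X_{n-1}$. $P(H_1,H_2,\ldots)$ means substitution of $H_j$ for $X_j$. -}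

module Defs where

open import Level using (Level; _⊔_) renaming (suc to lsuc)
open import Algebra.Bundles using (CommutativeRing)
open import Data.Nat as ℕ using (ℕ; zero; suc; _∸_; _!; _≤ᵇ_; _≡ᵇ_; NonZero)
open import Data.Nat.Properties using (m*n≢0; m^n≢0; _!≢0)
open import Data.Nat.DivMod using (_/_)
open import Data.Nat.Combinatorics using (_C_)
open import Data.Integer as ℤ using (ℤ; +_; -[1+_])
open import Data.Vec using (Vec; []; _∷_)
open import Data.List using (List; []; _∷_; map; concatMap; upTo; filter; foldr)
open import Data.Product using (_×_)
open import Data.Bool using (if_then_else_)
open import Relation.Nullary using (¬_)
open import Relation.Nullary.Decidable using (_×-dec_)
open import Relation.Binary.PropositionalEquality using (_≡_)

natEmb : ∀ {c ℓ} (R : CommutativeRing c ℓ) → ℕ → CommutativeRing.Carrier R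
natEmb R zero    = CommutativeRing.0# R
natEmb R (suc n) = CommutativeRing._+_ R (CommutativeRing.1# R) (natEmb R n)

-- A field of characteristic zero: a commutative ring, 1 ≠ 0, every nonzero
-- element has a multiplicative inverse (the inverse map is total; its value
-- at 0 is irrelevant), and n·1 ≠ 0 for every n ≥ 1.
record Char0Field (c ℓ : Level) : Set (lsuc (c ⊔ ℓ)) where
  field
    commutativeRing : CommutativeRing c ℓ
  open CommutativeRing commutativeRing public
  field
    _⁻¹     : Carrier → Carrier
    inverse : ∀ x → ¬ (x ≈ 0#) → (x * (x ⁻¹)) ≈ 1#
    1≉0     : ¬ (1# ≈ 0#)
    char0   : ∀ n → ¬ (natEmb commutativeRing (suc n) ≈ 0#)

vecsUpTo : (len b : ℕ) → List (Vec ℕ len)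
vecsUpTo zero    b = [] ∷ []
vecsUpTo (suc l) b = concatMap (λ v → map (λ r → r ∷ v) (upTo (suc b))) (vecsUpTo l b)

vsum : ∀ {l} → Vec ℕ l → ℕ
vsum []       = 0
vsum (r ∷ rs) = r ℕ.+ vsum rs

wsum : ∀ {l} → ℕ → Vec ℕ l → ℕ
wsum i []       = 0
wsum i (r ∷ rs) = i ℕ.* r ℕ.+ wsum (suc i) rs

den : ∀ {l} → ℕ → Vec ℕ l → ℕ
den i []       = 1
den i (r ∷ rs) = (r ! ℕ.* ((i !) ℕ.^ r)) ℕ.* den (suc i) rs

den-nz : ∀ {l} (i : ℕ) (rs : Vec ℕ l) → NonZero (den i rs)
den-nz i []       = _
den-nz i (r ∷ rs) =
  let instance
        a = r !≢0
        b = i !≢0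
        c = m^n≢0 (i !) r
        d = m*n≢0 (r !) ((i !) ℕ.^ r)
        e = den-nz (suc i) rs
  in m*n≢0 (r ! ℕ.* ((i !) ℕ.^ r)) (den (suc i) rs)


bellCoeff : ∀ {l} → ℕ → Vec ℕ l → ℕ
bellCoeff n rs = (n ! / den 1 rs) {{den-nz 1 rs}}

bellIndex : (n k : ℕ) → List (Vec ℕ n)
bellIndex n k = filter (λ rs → (vsum rs ℕ.≟ k) ×-dec (wsum 1 rs ℕ.≟ n)) (vecsUpTo n n)

falling : ℤ → ℕ → ℤ
falling r zero    = + 1
falling r (suc j) = falling r j ℤ.* (r ℤ.- + j)

module Polys {c ℓ : Level} (F : Char0Field c ℓ) where
  open Char0Field F public

  -- variables X_0, X_1, X_2, ... are evaluated at  x : ℕ → Carrier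
  Val : Set c
  Val = ℕ → Carrier

  ι : ℕ → Carrier
  ι = natEmb commutativeRing

  ιℤ : ℤ → Carrier
  ιℤ (+ n)    = ι n
  ιℤ -[1+ n ] = - ι (suc n)

  pow : Carrier → ℕ → Carrier
  pow a zero    = 1#
  pow a (suc m) = a * pow a m

  zpow : Carrier → ℤ → Carrier
  zpow a (+ m)    = pow a m
  zpow a -[1+ m ] = pow (a ⁻¹) (suc m)

  sumL : List Carrier → Carrier
  sumL = foldr _+_ 0#

  sumFromTo : ℕ → ℕ → (ℕ → Carrier) → Carrier
  sumFromTo a b f = sumL (map (λ t → f (a ℕ.+ t)) (upTo (suc b ∸ a)))

  mono : ∀ {l} → Val → ℕ → Vec ℕ l → Carrier
  mono x i []       = 1#
  mono x i (r ∷ rs) = pow (x i) r * mono x (suc i) rs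

  Bell : ℕ → ℕ → Val → Carrier
  Bell zero    zero    x = 1#
  Bell (suc n) zero    x = 0#
  Bell n       (suc k) x =
    if suc k ≤ᵇ n
    then sumL (map (λ rs → ι (bellCoeff n rs) * mono x 1 rs) (bellIndex n (suc k)))
    else 0#

  Phat : ℕ → ℤ → Val → Carrier
  Phat n r x = sumFromTo 0 n (λ j → ιℤ (falling r j) * zpow (x 0) (r ℤ.- + j) * Bell n j x)

  That : ℕ → Val → Carrier
  That zero    x = 0#   -- unused (T̂_n is only defined for n ≥ 1)
  That (suc m) x = sumFromTo 0 m (λ k → ιℤ (falling (+ suc m) k) * pow (x 0) (suc m ∸ k) * Bell m k x)

  -- the substitution X_j ↦ T̂_j (j ≥ 1); the X_0 slot is never read by B_{n,k}
  Tsub : Val → Val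
  Tsub x j = That j x

  δ : ℕ → ℕ → Carrier
  δ n k = if n ≡ᵇ k then 1# else 0#

  -- a : ℕ → ℕ → Carrier is the (values of the) family A_{n,k} at the point y,
  -- characterised as in the paper: lower triangular, A_{0,0}=1, A_{n,0}=0 (n≥1),
  -- Σ_{j=k}^n A_{n,j} B_{j,k} = δ_{nk}.
  IsBellInverse : (ℕ → ℕ → Carrier) → Val → Set ℓ
  IsBellInverse a y =
    (a 0 0 ≈ 1#)
    × (∀ n → a (suc n) 0 ≈ 0#)
    × (∀ n k → n ℕ.< k → a n k ≈ 0#)
    × (∀ n k → k ℕ.≤ n → sumFromTo k n (λ j → a n j * Bell j k y) ≈ δ n k)

module Submission where

-- Evaluate all polynomials at a point and work with ordinary power series over the field.
-- Put f = Σ_{j≥1} X_j t^j / j! and g = X₀ + f.  Then B_{n,k} = n! [tⁿ] f^k / k! and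
-- P̂_{m,r} = m! [t^m] g^r (for r ∈ ℕ, and for every integer r when X₀ is invertible).
-- The series τ = Σ_{j≥1} T̂_j t^j / j! satisfies τ = t · g(τ), so Lagrange inversion,
-- [tⁿ] τ^k = (k/n) [t^{n-k}] gⁿ, gives (i).  That coefficient formula is proved by strong
-- induction on n from Abel's identity (r + s) θ(g^r) g^s = r θ(g^{r+s}), θ = t d/dt.
-- For (ii), multiplying the matrix of (i) by the column C(l,k) P̂_{l-k,-k} gives the k-th
-- unit vector, by g^{-k} gⁿ = g^{n-k} and Abel's identity again; a left inverse of a
-- triangular matrix agrees with any such right-inverse column.

open import Defs
open import Level using (Level)
open import Algebra.Bundles using (CommutativeRing)
open import Data.Nat using (ℕ; _≤_; _∸_)
open import Data.Nat.Combinatorics using (_C_)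
open import Data.Integer as ℤ using (+_)
open import Data.Product using (_×_; _,_)
open import Relation.Nullary using (¬_)


module Factorials where

  open import Data.Nat as ℕ
  open import Data.Nat.Properties
  open import Data.Nat.Divisibility
  open import Data.Nat.DivMod using (m/n*n≡m)
  open import Data.Nat.Combinatorics using (k![n∸k]!∣n!)
  open import Data.Nat.Combinatorics.Specification using (nCk≡n!/k![n-k]!)
  open import Data.Vec using (Vec; []; _∷_)
  open import Data.Nat.Tactic.RingSolver using (solve-∀)
  open import Relation.Binary.PropositionalEquality
  open ≡-Reasoning

  nCk*k![n∸k]!≡n! : ∀ {n k} → k ≤ n → (n C k) * (k ! * (n ∸ k) !) ≡ n !
  nCk*k![n∸k]!≡n! {n} {k} k≤n = begin
    (n C k) * (k ! * (n ∸ k) !)        ≡⟨ cong (_* (k ! * (n ∸ k) !)) (nCk≡n!/k![n-k]! k≤n) ⟩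
    (n ! / (k ! * (n ∸ k) !)) * (k ! * (n ∸ k) !) ≡⟨ m/n*n≡m (k![n∸k]!∣n! k≤n) ⟩
    n !                                ∎
    where instance _ = k !* (n ∸ k) !≢0

  m!n!∣[m+n]! : ∀ m n → m ! * n ! ∣ (m + n) !
  m!n!∣[m+n]! m n = subst (λ t → m ! * t ! ∣ (m + n) !) (m+n∸m≡n m n) (k![n∸k]!∣n! (m≤m+n m n))

  r![[1+i]!]^r∣[[1+i]*r]! : ∀ i r → r ! * ((suc i !) ^ r) ∣ (suc i * r) !
  r![[1+i]!]^r∣[[1+i]*r]! i zero = subst (λ t → 1 ∣ t !) (sym (*-zeroʳ (suc i))) ∣-refl
  r![[1+i]!]^r∣[[1+i]*r]! i (suc r) with r![[1+i]!]^r∣[[1+i]*r]! i r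
  ... | divides q m!≡q*d = divides (((m + i) C i) * q) (begin
    (suc i * suc r) !                                   ≡⟨ cong _! suc[i]*suc[r]≡suc[m+i] ⟩
    suc (m + i) * (m + i) !                             ≡⟨ cong (suc (m + i) *_) (sym (nCk*k![n∸k]!≡n! (m≤n+m i m))) ⟩
    suc (m + i) * (((m + i) C i) * (i ! * (m + i ∸ i) !))  ≡⟨ cong (λ t → suc (m + i) * (((m + i) C i) * (i ! * t))) m!≡ ⟩
    suc (m + i) * (((m + i) C i) * (i ! * (q * (r ! * ((suc i !) ^ r)))))
      ≡⟨ cong (λ t → t * (((m + i) C i) * (i ! * (q * (r ! * ((suc i !) ^ r)))))) (sym suc[i]*suc[r]≡suc[m+i]) ⟩
    suc i * suc r * (((m + i) C i) * (i ! * (q * (r ! * ((suc i !) ^ r)))))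
      ≡⟨ rearrange (suc i) (suc r) ((m + i) C i) (i !) q (r !) ((suc i !) ^ r) ⟩
    ((m + i) C i) * q * (suc r * r ! * (suc i * i ! * (suc i !) ^ r)) ∎)
    where
    m = suc i * r
    suc[i]*suc[r]≡suc[m+i] : suc i * suc r ≡ suc (m + i)
    suc[i]*suc[r]≡suc[m+i] = trans (*-suc (suc i) r) (cong suc (+-comm i m))
    m!≡ : (m + i ∸ i) ! ≡ q * (r ! * ((suc i !) ^ r))
    m!≡ = trans (cong _! (m+n∸n≡m m i)) m!≡q*d
    rearrange : ∀ a b cm f q x y → a * b * (cm * (f * (q * (x * y)))) ≡ cm * q * (b * x * (a * f * y))
    rearrange = solve-∀

  den∣wsum! : ∀ {l} i (rs : Vec ℕ l) → den (suc i) rs ∣ (wsum (suc i) rs) !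
  den∣wsum! i []       = ∣-refl
  den∣wsum! i (r ∷ rs) =
    ∣-trans (*-pres-∣ (r![[1+i]!]^r∣[[1+i]*r]! i r) (den∣wsum! (suc i) rs)) (m!n!∣[m+n]! (suc i * r) (wsum (suc (suc i)) rs))


module FallingFactorial where

  open import Data.Nat as ℕ using (ℕ; zero; s≤s)
  import Data.Nat.Properties as ℕ
  open import Data.Integer
  open import Data.Integer.Properties using (pos-+; +-inverseʳ; *-zeroʳ)
  open import Data.Integer.Tactic.RingSolver using (solve-∀)
  open import Relation.Binary.PropositionalEquality
  open import Relation.Nullary using (yes; no)

  falling-suc-suc : ∀ r j → falling (suc r) (ℕ.suc j) ≡ suc r * falling r j
  falling-suc-suc r zero = lemma r
    where
    lemma : ∀ a → + 1 * ((+ 1 + a) - + 0) ≡ (+ 1 + a) * + 1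
    lemma = solve-∀
  falling-suc-suc r (ℕ.suc j) = begin
    falling (suc r) (ℕ.suc j) * (suc r - + ℕ.suc j)   ≡⟨ cong₂ (λ u v → u * (suc r - v)) (falling-suc-suc r j) (pos-+ 1 j) ⟩
    suc r * falling r j * (suc r - (+ 1 + + j))       ≡⟨ lemma (suc r) (falling r j) r (+ j) ⟩
    suc r * (falling r j * (r - + j))                 ∎
    where
    open ≡-Reasoning
    lemma : ∀ a f r j → a * f * ((+ 1 + r) - (+ 1 + j)) ≡ a * (f * (r - j))
    lemma = solve-∀

  falling-pascal : ∀ r s → falling (suc r) (ℕ.suc s) ≡ falling r (ℕ.suc s) + + ℕ.suc s * falling r s
  falling-pascal r zero = lemma r
    where
    lemma : ∀ a → + 1 * ((+ 1 + a) - + 0) ≡ + 1 * (a - + 0) + + 1 * + 1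
    lemma = solve-∀
  falling-pascal r (ℕ.suc s) = begin
    falling (suc r) (ℕ.suc s) * (suc r - + ℕ.suc s)
      ≡⟨ cong₂ (λ u v → u * (suc r - v)) (falling-pascal r s) (pos-+ 1 s) ⟩
    (falling r s * (r - + s) + (+ 1 + + s) * falling r s) * ((+ 1 + r) - (+ 1 + + s))
      ≡⟨ lemma (falling r s) r (+ s) ⟩
    falling r s * (r - + s) * (r - (+ 1 + + s)) + (+ 2 + + s) * (falling r s * (r - + s))
      ≡⟨ cong₂ (λ u v → falling r s * (r - + s) * (r - u) + v * (falling r s * (r - + s))) (sym (pos-+ 1 s)) (sym (pos-+ 2 s)) ⟩
    falling r (ℕ.suc (ℕ.suc s)) + + ℕ.suc (ℕ.suc s) * falling r (ℕ.suc s) ∎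
    where
    open ≡-Reasoning
    lemma : ∀ f r s → (f * (r - s) + (+ 1 + s) * f) * ((+ 1 + r) - (+ 1 + s))
                    ≡ f * (r - s) * (r - (+ 1 + s)) + (+ 2 + s) * (f * (r - s))
    lemma = solve-∀

  falling-vanishes : ∀ n j → n ℕ.< j → falling (+ n) j ≡ + 0
  falling-vanishes n (ℕ.suc j) (s≤s n≤j) with n ℕ.≟ j
  ... | yes refl = trans (cong (falling (+ n) n *_) (+-inverseʳ (+ n))) (*-zeroʳ (falling (+ n) n))
  ... | no n≢j   = cong (_* (+ n - + j)) (falling-vanishes n j (ℕ.≤∧≢⇒< n≤j n≢j))


module IntegerAsDifference where

  open import Data.Nat as ℕ using (ℕ; suc; z≤n)
  open import Data.Integer as ℤ using (ℤ; +_; -[1+_]; _⊖_)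
  import Data.Integer.Properties as ℤ
  open import Data.Integer.Tactic.RingSolver using (solve-∀)
  open import Relation.Binary.PropositionalEquality as P using (_≡_)
  open P.≡-Reasoning

  -- Writing every integer as m ⊖ n reduces the laws of ιℤ and zpow to those on ℕ.
  pos neg : ℤ → ℕ
  pos (+ m)    = m
  pos -[1+ n ] = 0
  neg (+ m)    = 0
  neg -[1+ n ] = suc n

  pos⊖neg : ∀ p → p ≡ pos p ⊖ neg p
  pos⊖neg (+ m)    = P.sym (ℤ.⊖-≥ z≤n)
  pos⊖neg -[1+ n ] = P.refl

  m⊖n≡+m-+n : ∀ m n → m ⊖ n ≡ + m ℤ.- + n
  m⊖n≡+m-+n m n = P.sym (ℤ.m-n≡m⊖n m n)

  ⊖-+ : ∀ a b c d → (a ⊖ b) ℤ.+ (c ⊖ d) ≡ (a ℕ.+ c) ⊖ (b ℕ.+ d)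
  ⊖-+ a b c d = begin
    (a ⊖ b) ℤ.+ (c ⊖ d)                     ≡⟨ P.cong₂ ℤ._+_ (m⊖n≡+m-+n a b) (m⊖n≡+m-+n c d) ⟩
    (+ a ℤ.- + b) ℤ.+ (+ c ℤ.- + d)          ≡⟨ lemma (+ a) (+ b) (+ c) (+ d) ⟩
    (+ a ℤ.+ + c) ℤ.- (+ b ℤ.+ + d)          ≡⟨ P.cong₂ ℤ._-_ (P.sym (ℤ.pos-+ a c)) (P.sym (ℤ.pos-+ b d)) ⟩
    + (a ℕ.+ c) ℤ.- + (b ℕ.+ d)              ≡⟨ P.sym (m⊖n≡+m-+n (a ℕ.+ c) (b ℕ.+ d)) ⟩
    (a ℕ.+ c) ⊖ (b ℕ.+ d)                    ∎
    where
    lemma : ∀ a b c d → (a ℤ.- b) ℤ.+ (c ℤ.- d) ≡ (a ℤ.+ c) ℤ.- (b ℤ.+ d)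
    lemma = solve-∀

  ⊖-* : ∀ a b c d → (a ⊖ b) ℤ.* (c ⊖ d) ≡ (a ℕ.* c ℕ.+ b ℕ.* d) ⊖ (a ℕ.* d ℕ.+ b ℕ.* c)
  ⊖-* a b c d = begin
    (a ⊖ b) ℤ.* (c ⊖ d)                                               ≡⟨ P.cong₂ ℤ._*_ (m⊖n≡+m-+n a b) (m⊖n≡+m-+n c d) ⟩
    (+ a ℤ.- + b) ℤ.* (+ c ℤ.- + d)                                    ≡⟨ lemma (+ a) (+ b) (+ c) (+ d) ⟩
    (+ a ℤ.* + c ℤ.+ + b ℤ.* + d) ℤ.- (+ a ℤ.* + d ℤ.+ + b ℤ.* + c)    ≡⟨ P.cong₂ ℤ._-_ (pos-+* a c b d) (pos-+* a d b c) ⟩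
    + (a ℕ.* c ℕ.+ b ℕ.* d) ℤ.- + (a ℕ.* d ℕ.+ b ℕ.* c)                ≡⟨ P.sym (m⊖n≡+m-+n (a ℕ.* c ℕ.+ b ℕ.* d) (a ℕ.* d ℕ.+ b ℕ.* c)) ⟩
    (a ℕ.* c ℕ.+ b ℕ.* d) ⊖ (a ℕ.* d ℕ.+ b ℕ.* c)                      ∎
    where
    lemma : ∀ a b c d → (a ℤ.- b) ℤ.* (c ℤ.- d) ≡ (a ℤ.* c ℤ.+ b ℤ.* d) ℤ.- (a ℤ.* d ℤ.+ b ℤ.* c)
    lemma = solve-∀
    pos-+* : ∀ a c b d → + a ℤ.* + c ℤ.+ + b ℤ.* + d ≡ + (a ℕ.* c ℕ.+ b ℕ.* d)
    pos-+* a c b d = P.trans (P.cong₂ ℤ._+_ (P.sym (ℤ.pos-* a c)) (P.sym (ℤ.pos-* b d))) (P.sym (ℤ.pos-+ (a ℕ.* c) (b ℕ.* d)))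


module FieldFacts {c ℓ : Level} (F : Char0Field c ℓ) where

  open import Data.Nat as ℕ using (zero; suc; _≤_; _∸_; _!)
  import Data.Nat.Properties as ℕ
  open import Data.Integer as ℤ using (ℤ; _⊖_)
  import Data.Integer.Properties as ℤ
  open import Data.Maybe as Maybe using (Maybe)
  open import Relation.Binary.Consequences using (dec⇒weaklyDec)
  open import Algebra.Solver.Ring.AlmostCommutativeRing using (_-Raw-AlmostCommutative⟶_)
    renaming (fromCommutativeRing to fromCommutativeRing′)
  import Algebra.Solver.Ring as IntegerCoefficientSolver
  import Relation.Binary.PropositionalEquality as P

  open IntegerAsDifference
  open Factorials using (nCk*k![n∸k]!≡n!)
  open Polys F public hiding (zero)
  open import Relation.Binary.Reasoning.Setoid setoid public
  open import Algebra.Properties.Ring ring using (-0#≈0#; -‿distribˡ-*; -‿distribʳ-*; -‿involutive)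
  open import Algebra.Properties.AbelianGroup +-abelianGroup using (⁻¹-∙-comm)
  open import Algebra.Properties.CommutativeSemigroup +-commutativeSemigroup using () renaming (interchange to +-interchange)
  open import Algebra.Properties.CommutativeSemigroup *-commutativeSemigroup using () renaming (interchange to *-interchange)

  ι-+ : ∀ m n → ι (m ℕ.+ n) ≈ ι m + ι n
  ι-+ zero    n = sym (+-identityˡ (ι n))
  ι-+ (suc m) n = trans (+-cong refl (ι-+ m n)) (sym (+-assoc 1# (ι m) (ι n)))

  ι-* : ∀ m n → ι (m ℕ.* n) ≈ ι m * ι n
  ι-* zero    n = sym (zeroˡ (ι n))
  ι-* (suc m) n = begin
    ι (n ℕ.+ m ℕ.* n)     ≈⟨ trans (ι-+ n (m ℕ.* n)) (+-cong refl (ι-* m n)) ⟩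
    ι n + ι m * ι n       ≈⟨ +-cong (sym (*-identityˡ (ι n))) refl ⟩
    1# * ι n + ι m * ι n  ≈⟨ sym (distribʳ (ι n) 1# (ι m)) ⟩
    (1# + ι m) * ι n      ∎

  ι1≈1 : ι 1 ≈ 1#
  ι1≈1 = +-identityʳ 1#

  ι-^ : ∀ a n → ι (a ℕ.^ n) ≈ pow (ι a) n
  ι-^ a zero    = ι1≈1
  ι-^ a (suc n) = trans (ι-* a (a ℕ.^ n)) (*-cong refl (ι-^ a n))

  ι-nonZero : ∀ n → .{{ℕ.NonZero n}} → ¬ (ι n ≈ 0#)
  ι-nonZero (suc n) = char0 n

  ι[n!]≉0 : ∀ n → ¬ (ι (n !) ≈ 0#)
  ι[n!]≉0 n = ι-nonZero (n !) {{n ℕ.!≢0}}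

  ⁻¹*x≈1 : ∀ {a} → ¬ (a ≈ 0#) → a ⁻¹ * a ≈ 1#
  ⁻¹*x≈1 {a} a≉0 = trans (*-comm _ _) (inverse a a≉0)

  ⁻¹-unique : ∀ {a b} → a * b ≈ 1# → a ⁻¹ ≈ b
  ⁻¹-unique {a} {b} ab≈1 = begin
    a ⁻¹              ≈⟨ sym (*-identityʳ _) ⟩
    a ⁻¹ * 1#         ≈⟨ *-cong refl (sym ab≈1) ⟩
    a ⁻¹ * (a * b)    ≈⟨ sym (*-assoc _ _ _) ⟩
    (a ⁻¹ * a) * b    ≈⟨ *-cong (⁻¹*x≈1 a≉0) refl ⟩
    1# * b            ≈⟨ *-identityˡ b ⟩
    b                 ∎
    where
    a≉0 : ¬ (a ≈ 0#)
    a≉0 a≈0 = 1≉0 (trans (sym ab≈1) (trans (*-cong a≈0 refl) (zeroˡ b)))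

  *-nonZero : ∀ {a b} → ¬ (a ≈ 0#) → ¬ (b ≈ 0#) → ¬ (a * b ≈ 0#)
  *-nonZero {a} {b} a≉0 b≉0 ab≈0 = 1≉0 (begin
    1#                        ≈⟨ sym (*-identityʳ 1#) ⟩
    1# * 1#                   ≈⟨ *-cong (sym (inverse a a≉0)) (sym (inverse b b≉0)) ⟩
    (a * a ⁻¹) * (b * b ⁻¹)   ≈⟨ *-interchange a (a ⁻¹) b (b ⁻¹) ⟩
    (a * b) * (a ⁻¹ * b ⁻¹)   ≈⟨ trans (*-cong ab≈0 refl) (zeroˡ _) ⟩
    0#                        ∎)

  pow-nonZero : ∀ {a} n → ¬ (a ≈ 0#) → ¬ (pow a n ≈ 0#)
  pow-nonZero zero    a≉0 = 1≉0
  pow-nonZero (suc n) a≉0 = *-nonZero a≉0 (pow-nonZero n a≉0)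

  ⁻¹-* : ∀ {a b} → ¬ (a ≈ 0#) → ¬ (b ≈ 0#) → (a * b) ⁻¹ ≈ a ⁻¹ * b ⁻¹
  ⁻¹-* {a} {b} a≉0 b≉0 = ⁻¹-unique (begin
    (a * b) * (a ⁻¹ * b ⁻¹)   ≈⟨ *-interchange a b (a ⁻¹) (b ⁻¹) ⟩
    (a * a ⁻¹) * (b * b ⁻¹)   ≈⟨ *-cong (inverse a a≉0) (inverse b b≉0) ⟩
    1# * 1#                   ≈⟨ *-identityʳ 1# ⟩
    1#                        ∎)

  ⁻¹-cong : ∀ {a b} → ¬ (a ≈ 0#) → a ≈ b → a ⁻¹ ≈ b ⁻¹
  ⁻¹-cong a≉0 a≈b = ⁻¹-unique (trans (*-cong a≈b refl) (inverse _ (λ b≈0 → a≉0 (trans a≈b b≈0))))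

  *-cancelˡ : ∀ {a x y} → ¬ (a ≈ 0#) → a * x ≈ a * y → x ≈ y
  *-cancelˡ {a} {x} {y} a≉0 ax≈ay = begin
    x                  ≈⟨ sym (trans (*-cong (⁻¹*x≈1 a≉0) refl) (*-identityˡ x)) ⟩
    (a ⁻¹ * a) * x     ≈⟨ *-assoc _ _ _ ⟩
    a ⁻¹ * (a * x)     ≈⟨ *-cong refl ax≈ay ⟩
    a ⁻¹ * (a * y)     ≈⟨ sym (*-assoc _ _ _) ⟩
    (a ⁻¹ * a) * y     ≈⟨ trans (*-cong (⁻¹*x≈1 a≉0) refl) (*-identityˡ y) ⟩
    y                  ∎

  *≈⇒≈⁻¹* : ∀ {a x y} → ¬ (a ≈ 0#) → a * x ≈ y → x ≈ a ⁻¹ * y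
  *≈⇒≈⁻¹* {a} {x} {y} a≉0 ax≈y = *-cancelˡ a≉0 (begin
    a * x              ≈⟨ ax≈y ⟩
    y                  ≈⟨ sym (trans (*-cong (inverse a a≉0) refl) (*-identityˡ y)) ⟩
    (a * a ⁻¹) * y     ≈⟨ *-assoc _ _ _ ⟩
    a * (a ⁻¹ * y)     ∎)

  ι⁻¹ : ℕ → Carrier
  ι⁻¹ n = (ι n) ⁻¹

  ι*ι⁻¹ : ∀ n → .{{ℕ.NonZero n}} → ι n * ι⁻¹ n ≈ 1#
  ι*ι⁻¹ n = inverse (ι n) (ι-nonZero n)

  ι[n!]*ι⁻¹[n!] : ∀ n → ι (n !) * ι⁻¹ (n !) ≈ 1#
  ι[n!]*ι⁻¹[n!] n = inverse (ι (n !)) (ι[n!]≉0 n)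

  ι⁻¹[suc-n!] : ∀ k → ι⁻¹ (suc k !) ≈ ι⁻¹ (suc k) * ι⁻¹ (k !)
  ι⁻¹[suc-n!] k = trans (⁻¹-cong (ι[n!]≉0 (suc k)) (ι-* (suc k) (k !))) (⁻¹-* (char0 k) (ι[n!]≉0 k))

  pow-cong : ∀ {a b} n → a ≈ b → pow a n ≈ pow b n
  pow-cong zero    a≈b = refl
  pow-cong (suc n) a≈b = *-cong a≈b (pow-cong n a≈b)

  pow-+ : ∀ a m n → pow a (m ℕ.+ n) ≈ pow a m * pow a n
  pow-+ a zero    n = sym (*-identityˡ _)
  pow-+ a (suc m) n = trans (*-cong refl (pow-+ a m n)) (sym (*-assoc _ _ _))

  pow-* : ∀ a b n → pow (a * b) n ≈ pow a n * pow b n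
  pow-* a b zero    = sym (*-identityʳ 1#)
  pow-* a b (suc n) = trans (*-cong refl (pow-* a b n))
    (*-interchange a b (pow a n) (pow b n))

  pow-⁻¹ : ∀ {a} r → ¬ (a ≈ 0#) → (pow a r) ⁻¹ ≈ pow (a ⁻¹) r
  pow-⁻¹ {a} r a≉0 = ⁻¹-unique (trans (sym (pow-* a (a ⁻¹) r)) (trans (pow-cong r (inverse a a≉0)) (pow-1 r)))
    where
    pow-1 : ∀ n → pow 1# n ≈ 1#
    pow-1 zero    = refl
    pow-1 (suc n) = trans (*-identityˡ _) (pow-1 n)

  ιℤ-⊖ : ∀ m n → ιℤ (m ⊖ n) ≈ ι m - ι n
  ιℤ-⊖ zero    zero    = sym (-‿inverseʳ 0#)
  ιℤ-⊖ zero    (suc n) = sym (+-identityˡ _)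
  ιℤ-⊖ (suc m) zero    = sym (trans (+-cong refl -0#≈0#) (+-identityʳ _))
  ιℤ-⊖ (suc m) (suc n) = begin
    ιℤ (suc m ⊖ suc n)             ≈⟨ reflexive (P.cong ιℤ (ℤ.[1+m]⊖[1+n]≡m⊖n m n)) ⟩
    ιℤ (m ⊖ n)                     ≈⟨ ιℤ-⊖ m n ⟩
    ι m - ι n                      ≈⟨ sym (+-identityˡ _) ⟩
    0# + (ι m - ι n)               ≈⟨ +-cong (sym (-‿inverseʳ 1#)) refl ⟩
    (1# - 1#) + (ι m - ι n)        ≈⟨ +-interchange 1# (- 1#) (ι m) (- ι n) ⟩
    (1# + ι m) + (- 1# + - ι n)    ≈⟨ +-cong refl (⁻¹-∙-comm 1# (ι n)) ⟩
    ι (suc m) - ι (suc n)          ∎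

  private
    ιℤ≈ι-ι : ∀ p → ιℤ p ≈ ι (pos p) - ι (neg p)
    ιℤ≈ι-ι p = trans (reflexive (P.cong ιℤ (pos⊖neg p))) (ιℤ-⊖ (pos p) (neg p))

  ιℤ-+ : ∀ p q → ιℤ (p ℤ.+ q) ≈ ιℤ p + ιℤ q
  ιℤ-+ p q = begin
    ιℤ (p ℤ.+ q)                 ≈⟨ reflexive (P.cong ιℤ (P.trans (P.cong₂ ℤ._+_ (pos⊖neg p) (pos⊖neg q)) (⊖-+ a b c′ d))) ⟩
    ιℤ ((a ℕ.+ c′) ⊖ (b ℕ.+ d))  ≈⟨ ιℤ-⊖ (a ℕ.+ c′) (b ℕ.+ d) ⟩
    ι (a ℕ.+ c′) - ι (b ℕ.+ d)   ≈⟨ +-cong (ι-+ a c′) (-‿cong (ι-+ b d)) ⟩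
    (ι a + ι c′) - (ι b + ι d)   ≈⟨ +-cong refl (sym (⁻¹-∙-comm (ι b) (ι d))) ⟩
    (ι a + ι c′) + (- ι b + - ι d) ≈⟨ +-interchange (ι a) (ι c′) (- ι b) (- ι d) ⟩
    (ι a - ι b) + (ι c′ - ι d)   ≈⟨ sym (+-cong (ιℤ≈ι-ι p) (ιℤ≈ι-ι q)) ⟩
    ιℤ p + ιℤ q                  ∎
    where a = pos p ; b = neg p ; c′ = pos q ; d = neg q

  -distrib-* : ∀ x y z w → (x - y) * (z - w) ≈ (x * z + y * w) - (x * w + y * z)
  -distrib-* x y z w = begin
    (x - y) * (z - w)
      ≈⟨ trans (distribʳ (z - w) x (- y)) (+-cong (distribˡ x z (- w)) (distribˡ (- y) z (- w))) ⟩
    (x * z + x * - w) + (- y * z + - y * - w)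
      ≈⟨ +-cong (+-cong refl (sym (-‿distribʳ-* x w))) (+-cong (sym (-‿distribˡ-* y z)) -y*-w≈y*w) ⟩
    (x * z + - (x * w)) + (- (y * z) + y * w)
      ≈⟨ trans (+-cong refl (+-comm _ _)) (+-interchange (x * z) (- (x * w)) (y * w) (- (y * z))) ⟩
    (x * z + y * w) + (- (x * w) + - (y * z))
      ≈⟨ +-cong refl (⁻¹-∙-comm (x * w) (y * z)) ⟩
    (x * z + y * w) - (x * w + y * z) ∎
    where
    -y*-w≈y*w : - y * - w ≈ y * w
    -y*-w≈y*w = trans (sym (-‿distribˡ-* y (- w))) (trans (-‿cong (sym (-‿distribʳ-* y w))) (-‿involutive _))

  ιℤ-* : ∀ p q → ιℤ (p ℤ.* q) ≈ ιℤ p * ιℤ q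
  ιℤ-* p q = begin
    ιℤ (p ℤ.* q)
      ≈⟨ reflexive (P.cong ιℤ (P.trans (P.cong₂ ℤ._*_ (pos⊖neg p) (pos⊖neg q)) (⊖-* a b c′ d))) ⟩
    ιℤ ((a ℕ.* c′ ℕ.+ b ℕ.* d) ⊖ (a ℕ.* d ℕ.+ b ℕ.* c′))
      ≈⟨ ιℤ-⊖ (a ℕ.* c′ ℕ.+ b ℕ.* d) (a ℕ.* d ℕ.+ b ℕ.* c′) ⟩
    ι (a ℕ.* c′ ℕ.+ b ℕ.* d) - ι (a ℕ.* d ℕ.+ b ℕ.* c′)
      ≈⟨ +-cong (ι-+* a c′ b d) (-‿cong (ι-+* a d b c′)) ⟩
    (ι a * ι c′ + ι b * ι d) - (ι a * ι d + ι b * ι c′)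
      ≈⟨ sym (-distrib-* (ι a) (ι b) (ι c′) (ι d)) ⟩
    (ι a - ι b) * (ι c′ - ι d)
      ≈⟨ sym (*-cong (ιℤ≈ι-ι p) (ιℤ≈ι-ι q)) ⟩
    ιℤ p * ιℤ q ∎
    where
    a = pos p ; b = neg p ; c′ = pos q ; d = neg q
    ι-+* : ∀ a c b d → ι (a ℕ.* c ℕ.+ b ℕ.* d) ≈ ι a * ι c + ι b * ι d
    ι-+* a c b d = trans (ι-+ (a ℕ.* c) (b ℕ.* d)) (+-cong (ι-* a c) (ι-* b d))

  ιℤ-neg : ∀ p → ιℤ (ℤ.- p) ≈ - ιℤ p
  ιℤ-neg p = begin
    ιℤ (ℤ.- p)             ≈⟨ reflexive (P.cong ιℤ (P.trans (P.cong ℤ.-_ (pos⊖neg p)) (P.sym (ℤ.⊖-swap (neg p) (pos p))))) ⟩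
    ιℤ (neg p ⊖ pos p)     ≈⟨ ιℤ-⊖ (neg p) (pos p) ⟩
    ι (neg p) - ι (pos p)  ≈⟨ +-comm _ _ ⟩
    - ι (pos p) + ι (neg p)   ≈⟨ +-cong refl (sym (-‿involutive _)) ⟩
    - ι (pos p) + - - ι (neg p) ≈⟨ ⁻¹-∙-comm _ _ ⟩
    - (ι (pos p) - ι (neg p)) ≈⟨ -‿cong (sym (ιℤ≈ι-ι p)) ⟩
    - ιℤ p                 ∎

  ιℤ-homomorphism : ℤ.+-*-rawRing -Raw-AlmostCommutative⟶ fromCommutativeRing′ commutativeRing
  ιℤ-homomorphism = record
    { ⟦_⟧ = ιℤ ; +-homo = ιℤ-+ ; *-homo = ιℤ-* ; -‿homo = ιℤ-neg ; 0-homo = refl ; 1-homo = ι1≈1 }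

  private
    ιℤ-≟ : ∀ a b → Maybe (ιℤ a ≈ ιℤ b)
    ιℤ-≟ a b = Maybe.map (λ a≡b → reflexive (P.cong ιℤ a≡b)) (dec⇒weaklyDec ℤ._≟_ a b)

  open IntegerCoefficientSolver ℤ.+-*-rawRing (fromCommutativeRing′ commutativeRing) ιℤ-homomorphism ιℤ-≟ public
    using (_:+_; _:*_; :-_; _:-_; _:=_; con) renaming (solve to zsolve)

  zpow-⊖ : ∀ {a} → ¬ (a ≈ 0#) → ∀ m n → zpow a (m ⊖ n) ≈ pow a m * pow (a ⁻¹) n
  zpow-⊖ a≉0 zero    zero    = sym (*-identityˡ 1#)
  zpow-⊖ a≉0 zero    (suc n) = sym (*-identityˡ _)
  zpow-⊖ a≉0 (suc m) zero    = sym (*-identityʳ _)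
  zpow-⊖ {a} a≉0 (suc m) (suc n) = begin
    zpow a (suc m ⊖ suc n)                 ≈⟨ reflexive (P.cong (zpow a) (ℤ.[1+m]⊖[1+n]≡m⊖n m n)) ⟩
    zpow a (m ⊖ n)                         ≈⟨ zpow-⊖ a≉0 m n ⟩
    pow a m * pow (a ⁻¹) n                 ≈⟨ sym (trans (*-cong (inverse a a≉0) refl) (*-identityˡ _)) ⟩
    (a * a ⁻¹) * (pow a m * pow (a ⁻¹) n)  ≈⟨ *-interchange a (a ⁻¹) (pow a m) (pow (a ⁻¹) n) ⟩
    pow a (suc m) * pow (a ⁻¹) (suc n)     ∎

  zpow-+ : ∀ {a} → ¬ (a ≈ 0#) → ∀ p q → zpow a (p ℤ.+ q) ≈ zpow a p * zpow a q
  zpow-+ {a} a≉0 p q = begin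
    zpow a (p ℤ.+ q)                                       ≈⟨ reflexive (P.cong (zpow a) (P.trans (P.cong₂ ℤ._+_ (pos⊖neg p) (pos⊖neg q)) (⊖-+ m n m′ n′))) ⟩
    zpow a ((m ℕ.+ m′) ⊖ (n ℕ.+ n′))                       ≈⟨ zpow-⊖ a≉0 (m ℕ.+ m′) (n ℕ.+ n′) ⟩
    pow a (m ℕ.+ m′) * pow (a ⁻¹) (n ℕ.+ n′)               ≈⟨ *-cong (pow-+ a m m′) (pow-+ (a ⁻¹) n n′) ⟩
    (pow a m * pow a m′) * (pow (a ⁻¹) n * pow (a ⁻¹) n′)  ≈⟨ *-interchange (pow a m) (pow a m′) (pow (a ⁻¹) n) (pow (a ⁻¹) n′) ⟩
    (pow a m * pow (a ⁻¹) n) * (pow a m′ * pow (a ⁻¹) n′)  ≈⟨ sym (*-cong (zpow≈ p) (zpow≈ q)) ⟩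
    zpow a p * zpow a q                                    ∎
    where
    m = pos p ; n = neg p ; m′ = pos q ; n′ = neg q
    zpow≈ : ∀ p → zpow a p ≈ pow a (pos p) * pow (a ⁻¹) (neg p)
    zpow≈ p = trans (reflexive (P.cong (zpow a) (pos⊖neg p))) (zpow-⊖ a≉0 (pos p) (neg p))

  ι[nCk]*ι[[n∸k]!]≈ι[n!]*ι⁻¹[k!] : ∀ {n k} → k ≤ n → ι (n C k) * ι ((n ∸ k) !) ≈ ι (n !) * ι⁻¹ (k !)
  ι[nCk]*ι[[n∸k]!]≈ι[n!]*ι⁻¹[k!] {n} {k} k≤n = trans (*≈⇒≈⁻¹* (ι[n!]≉0 k) k!*nCk*[n∸k]!≈n!) (*-comm _ _)
    where
    k!*nCk*[n∸k]!≈n! : ι (k !) * (ι (n C k) * ι ((n ∸ k) !)) ≈ ι (n !)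
    k!*nCk*[n∸k]!≈n! = begin
      ι (k !) * (ι (n C k) * ι ((n ∸ k) !))     ≈⟨ zsolve 3 (λ a b c → (a :* (b :* c)) := (b :* (a :* c))) refl (ι (k !)) (ι (n C k)) (ι ((n ∸ k) !)) ⟩
      ι (n C k) * (ι (k !) * ι ((n ∸ k) !))     ≈⟨ sym (trans (ι-* (n C k) (k ! ℕ.* (n ∸ k) !)) (*-cong refl (ι-* (k !) ((n ∸ k) !)))) ⟩
      ι ((n C k) ℕ.* (k ! ℕ.* (n ∸ k) !))       ≈⟨ reflexive (P.cong ι (nCk*k![n∸k]!≡n! k≤n)) ⟩
      ι (n !)                                    ∎


module FiniteSums {c ℓ : Level} (R : CommutativeRing c ℓ) where

  open import Data.Nat as ℕ using (ℕ; zero; suc; _∸_; _≤_; _<_; z≤n; s≤s)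
  import Data.Nat.Properties as ℕ
  open import Relation.Binary.PropositionalEquality as P using (_≡_)
  open import Relation.Nullary using (¬_)
  open CommutativeRing R hiding (zero)
  open import Relation.Binary.Reasoning.Setoid setoid
  open import Algebra.Properties.CommutativeSemigroup +-commutativeSemigroup using () renaming (interchange to +-interchange)

  opaque
    ∑ : ℕ → (ℕ → Carrier) → Carrier
    ∑ zero    f = 0#
    ∑ (suc n) f = f 0 + ∑ n (λ i → f (suc i))

    ∑-zero : ∀ f → ∑ zero f ≈ 0#
    ∑-zero f = refl

    ∑-suc : ∀ n f → ∑ (suc n) f ≈ f 0 + ∑ n (λ i → f (suc i))
    ∑-suc n f = refl

    ∑-cong< : ∀ n {f g} → (∀ i → i < n → f i ≈ g i) → ∑ n f ≈ ∑ n g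
    ∑-cong< zero    f≈g = refl
    ∑-cong< (suc n) f≈g = +-cong (f≈g 0 (s≤s z≤n)) (∑-cong< n (λ i i<n → f≈g (suc i) (s≤s i<n)))

    ∑-+ : ∀ n f g → ∑ n (λ i → f i + g i) ≈ ∑ n f + ∑ n g
    ∑-+ zero    f g = sym (+-identityˡ 0#)
    ∑-+ (suc n) f g = begin
      (f 0 + g 0) + ∑ n (λ i → f (suc i) + g (suc i))                    ≈⟨ +-cong refl (∑-+ n _ _) ⟩
      (f 0 + g 0) + (∑ n (λ i → f (suc i)) + ∑ n (λ i → g (suc i)))      ≈⟨ +-interchange (f 0) (g 0) _ _ ⟩
      (f 0 + ∑ n (λ i → f (suc i))) + (g 0 + ∑ n (λ i → g (suc i)))      ∎

    ∑-*ˡ : ∀ n a f → a * ∑ n f ≈ ∑ n (λ i → a * f i)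
    ∑-*ˡ zero    a f = zeroʳ a
    ∑-*ˡ (suc n) a f = trans (distribˡ a _ _) (+-cong refl (∑-*ˡ n a _))

    ∑-≈0 : ∀ n {f} → (∀ i → i < n → f i ≈ 0#) → ∑ n f ≈ 0#
    ∑-≈0 zero    f≈0 = refl
    ∑-≈0 (suc n) f≈0 = trans (+-cong (f≈0 0 (s≤s z≤n)) (∑-≈0 n (λ i i<n → f≈0 (suc i) (s≤s i<n)))) (+-identityˡ 0#)

    ∑-last : ∀ n f → ∑ (suc n) f ≈ ∑ n f + f n
    ∑-last zero    f = trans (+-identityʳ _) (sym (+-identityˡ _))
    ∑-last (suc n) f = trans (+-cong refl (∑-last n _)) (sym (+-assoc _ _ _))

    ∑-split : ∀ m n f → ∑ (m ℕ.+ n) f ≈ ∑ m f + ∑ n (λ i → f (m ℕ.+ i))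
    ∑-split zero    n f = sym (+-identityˡ _)
    ∑-split (suc m) n f = trans (+-cong refl (∑-split m n _)) (sym (+-assoc _ _ _))

    ∑-comm : ∀ m n (f : ℕ → ℕ → Carrier) → ∑ m (λ i → ∑ n (f i)) ≈ ∑ n (λ j → ∑ m (λ i → f i j))
    ∑-comm zero    n f = sym (∑-≈0 n (λ _ _ → refl))
    ∑-comm (suc m) n f = begin
      ∑ n (f 0) + ∑ m (λ i → ∑ n (f (suc i)))                   ≈⟨ +-cong refl (∑-comm m n (λ i → f (suc i))) ⟩
      ∑ n (f 0) + ∑ n (λ j → ∑ m (λ i → f (suc i) j))           ≈⟨ sym (∑-+ n (f 0) (λ j → ∑ m (λ i → f (suc i) j))) ⟩
      ∑ n (λ j → f 0 j + ∑ m (λ i → f (suc i) j))               ∎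

  ∑-cong : ∀ n {f g} → (∀ i → f i ≈ g i) → ∑ n f ≈ ∑ n g
  ∑-cong n f≈g = ∑-cong< n (λ i _ → f≈g i)

  ∑-*ʳ : ∀ n a f → ∑ n f * a ≈ ∑ n (λ i → f i * a)
  ∑-*ʳ n a f = trans (*-comm _ _) (trans (∑-*ˡ n a f) (∑-cong n (λ i → *-comm _ _)))

  ∑-*-∑ : ∀ m n f g → ∑ m f * ∑ n g ≈ ∑ m (λ p → ∑ n (λ q → f p * g q))
  ∑-*-∑ m n f g = trans (∑-*ʳ m (∑ n g) f) (∑-cong m (λ p → ∑-*ˡ n (f p) g))

  ∑-one : ∀ f → ∑ 1 f ≈ f 0
  ∑-one f = trans (∑-suc 0 f) (trans (+-cong refl (∑-zero _)) (+-identityʳ _))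

  ∑-≡ : ∀ {m n} f → m ≡ n → ∑ m f ≈ ∑ n f
  ∑-≡ f P.refl = refl

  ∑-extend : ∀ {m n} f → m ≤ n → (∀ i → m ≤ i → i < n → f i ≈ 0#) → ∑ n f ≈ ∑ m f
  ∑-extend {m} {n} f m≤n f≈0 = begin
    ∑ n f                                          ≈⟨ ∑-≡ f (P.sym (ℕ.m+[n∸m]≡n m≤n)) ⟩
    ∑ (m ℕ.+ (n ∸ m)) f                            ≈⟨ ∑-split m (n ∸ m) f ⟩
    ∑ m f + ∑ (n ∸ m) (λ i → f (m ℕ.+ i))          ≈⟨ +-cong refl (∑-≈0 (n ∸ m) tail≈0) ⟩
    ∑ m f + 0#                                     ≈⟨ +-identityʳ _ ⟩
    ∑ m f                                          ∎
    where
    tail≈0 : ∀ i → i < n ∸ m → f (m ℕ.+ i) ≈ 0#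
    tail≈0 i i<n∸m = f≈0 (m ℕ.+ i) (ℕ.m≤m+n m i) (P.subst (m ℕ.+ i <_) (ℕ.m+[n∸m]≡n m≤n) (ℕ.+-monoʳ-< m i<n∸m))

  ∑-reverse : ∀ n f → ∑ n f ≈ ∑ n (λ i → f (n ∸ suc i))
  ∑-reverse zero    f = trans (∑-zero f) (sym (∑-zero _))
  ∑-reverse (suc n) f = begin
    ∑ (suc n) f                                           ≈⟨ ∑-suc n f ⟩
    f 0 + ∑ n (λ i → f (suc i))                           ≈⟨ +-cong refl (∑-reverse n _) ⟩
    f 0 + ∑ n (λ i → f (suc (n ∸ suc i)))                 ≈⟨ +-comm _ _ ⟩
    ∑ n (λ i → f (suc (n ∸ suc i))) + f 0                 ≈⟨ +-cong (∑-cong< n (λ i i<n → reflexive (P.cong f (P.sym (ℕ.+-∸-assoc 1 i<n)))))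
                                                                     (reflexive (P.cong f (P.sym (ℕ.n∸n≡0 n)))) ⟩
    ∑ n (λ i → f (suc n ∸ suc i)) + f (suc n ∸ suc n)     ≈⟨ sym (∑-last n _) ⟩
    ∑ (suc n) (λ i → f (suc n ∸ suc i))                   ∎

  ∑-single : ∀ n a f → a < n → (∀ i → i < n → ¬ (i ≡ a) → f i ≈ 0#) → ∑ n f ≈ f a
  ∑-single (suc n) zero    f a<n f≈0 = begin
    ∑ (suc n) f                  ≈⟨ ∑-suc n f ⟩
    f 0 + ∑ n (λ i → f (suc i))  ≈⟨ +-cong refl (∑-≈0 n (λ i i<n → f≈0 (suc i) (s≤s i<n) (λ ()))) ⟩
    f 0 + 0#                     ≈⟨ +-identityʳ _ ⟩
    f 0                          ∎
  ∑-single (suc n) (suc a) f (s≤s a<n) f≈0 = begin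
    ∑ (suc n) f                  ≈⟨ ∑-suc n f ⟩
    f 0 + ∑ n (λ i → f (suc i))  ≈⟨ +-cong (f≈0 0 (s≤s z≤n) (λ ())) (∑-single n a _ a<n (λ i i<n i≢a → f≈0 (suc i) (s≤s i<n) (λ e → i≢a (ℕ.suc-injective e)))) ⟩
    0# + f (suc a)               ≈⟨ +-identityˡ _ ⟩
    f (suc a)                    ∎

  ∑-triangle : ∀ n (G : ℕ → ℕ → Carrier) →
    ∑ (suc n) (λ s → ∑ (suc s) (λ i → G i (s ∸ i))) ≈ ∑ (suc n) (λ i → ∑ (suc (n ∸ i)) (G i))
  ∑-triangle zero    G = trans (∑-one _) (trans (∑-one _) (sym (trans (∑-one _) (∑-one _))))
  ∑-triangle (suc n) G = begin
    ∑ (suc (suc n)) (λ s → ∑ (suc s) (λ i → G i (s ∸ i)))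
      ≈⟨ ∑-last (suc n) _ ⟩
    ∑ (suc n) (λ s → ∑ (suc s) (λ i → G i (s ∸ i))) + ∑ (suc (suc n)) (λ i → G i (suc n ∸ i))
      ≈⟨ +-cong (∑-triangle n G) (∑-last (suc n) _) ⟩
    ∑ (suc n) (λ i → ∑ (suc (n ∸ i)) (G i)) + (∑ (suc n) (λ i → G i (suc n ∸ i)) + G (suc n) (suc n ∸ suc n))
      ≈⟨ sym (+-assoc _ _ _) ⟩
    (∑ (suc n) (λ i → ∑ (suc (n ∸ i)) (G i)) + ∑ (suc n) (λ i → G i (suc n ∸ i))) + G (suc n) (suc n ∸ suc n)
      ≈⟨ +-cong (sym (∑-+ (suc n) _ _)) (reflexive (P.cong (G (suc n)) (ℕ.n∸n≡0 n))) ⟩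
    ∑ (suc n) (λ i → ∑ (suc (n ∸ i)) (G i) + G i (suc n ∸ i)) + G (suc n) 0
      ≈⟨ +-cong (∑-cong< (suc n) (λ i i≤n → extendRow i (ℕ.≤-pred i≤n))) (sym (∑-one _)) ⟩
    ∑ (suc n) (λ i → ∑ (suc (suc n ∸ i)) (G i)) + ∑ 1 (G (suc n))
      ≈⟨ +-cong refl (∑-≡ (G (suc n)) (P.cong suc (P.sym (ℕ.n∸n≡0 n)))) ⟩
    ∑ (suc n) (λ i → ∑ (suc (suc n ∸ i)) (G i)) + ∑ (suc (suc n ∸ suc n)) (G (suc n))
      ≈⟨ sym (∑-last (suc n) (λ i → ∑ (suc (suc n ∸ i)) (G i))) ⟩
    ∑ (suc (suc n)) (λ i → ∑ (suc (suc n ∸ i)) (G i)) ∎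
    where
    extendRow : ∀ i → i ≤ n → ∑ (suc (n ∸ i)) (G i) + G i (suc n ∸ i) ≈ ∑ (suc (suc n ∸ i)) (G i)
    extendRow i i≤n = begin
      ∑ (suc (n ∸ i)) (G i) + G i (suc n ∸ i)        ≈⟨ +-cong refl (reflexive (P.cong (G i) (ℕ.+-∸-assoc 1 i≤n))) ⟩
      ∑ (suc (n ∸ i)) (G i) + G i (suc (n ∸ i))      ≈⟨ sym (∑-last (suc (n ∸ i)) _) ⟩
      ∑ (suc (suc (n ∸ i))) (G i)                    ≈⟨ ∑-≡ (G i) (P.cong suc (P.sym (ℕ.+-∸-assoc 1 i≤n))) ⟩
      ∑ (suc (suc n ∸ i)) (G i)                      ∎


module PowerSeries {c ℓ : Level} (R : CommutativeRing c ℓ) where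

  open import Data.Nat as ℕ using (ℕ; zero; suc; _∸_; _≤_; _<_; z≤n; s≤s)
  import Data.Nat.Properties as ℕ
  open import Data.Empty using (⊥-elim)
  open import Relation.Binary.PropositionalEquality as P using (_≡_)
  open CommutativeRing R hiding (zero)
  open import Relation.Binary.Reasoning.Setoid setoid
  open import Algebra.Properties.CommutativeSemigroup *-commutativeSemigroup using (interchange; x∙yz≈y∙xz)
  open FiniteSums R public

  Series : Set c
  Series = ℕ → Carrier

  infix 4 _≋_
  _≋_ : Series → Series → Set ℓ
  a ≋ b = ∀ n → a n ≈ b n

  conv : Series → Series → Series
  conv a b n = ∑ (suc n) (λ i → a i * b (n ∸ i))

  1ˢ : Series
  1ˢ zero    = 1#
  1ˢ (suc n) = 0#

  0ˢ : Series
  0ˢ n = 0#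

  _⊞_ : Series → Series → Series
  (a ⊞ b) n = a n + b n

  _•_ : Carrier → Series → Series
  (x • a) n = x * a n

  ∑ˢ : ℕ → (ℕ → Series) → Series
  ∑ˢ m X n = ∑ m (λ r → X r n)

  conv-cong : ∀ {a a′ b b′} → a ≋ a′ → b ≋ b′ → conv a b ≋ conv a′ b′
  conv-cong a≋a′ b≋b′ n = ∑-cong (suc n) (λ i → *-cong (a≋a′ i) (b≋b′ (n ∸ i)))

  conv-cong≤ : ∀ {a a′ b b′} n → (∀ i → i ≤ n → a i ≈ a′ i) → (∀ i → i ≤ n → b i ≈ b′ i) → conv a b n ≈ conv a′ b′ n
  conv-cong≤ n a≈a′ b≈b′ = ∑-cong< (suc n) (λ i i≤n → *-cong (a≈a′ i (ℕ.≤-pred i≤n)) (b≈b′ (n ∸ i) (ℕ.m∸n≤m n i)))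

  conv-comm : ∀ a b → conv a b ≋ conv b a
  conv-comm a b n = begin
    ∑ (suc n) (λ i → a i * b (n ∸ i))                ≈⟨ ∑-reverse (suc n) (λ i → a i * b (n ∸ i)) ⟩
    ∑ (suc n) (λ i → a (n ∸ i) * b (n ∸ (n ∸ i)))    ≈⟨ ∑-cong< (suc n) (λ i i≤n → trans (*-comm _ _) (*-cong (reflexive (P.cong b (ℕ.m∸[m∸n]≡n (ℕ.≤-pred i≤n)))) refl)) ⟩
    ∑ (suc n) (λ i → b i * a (n ∸ i))                ∎

  conv-assoc : ∀ a b d → conv (conv a b) d ≋ conv a (conv b d)
  conv-assoc a b d n = begin
    ∑ (suc n) (λ s → ∑ (suc s) (λ i → a i * b (s ∸ i)) * d (n ∸ s))
      ≈⟨ ∑-cong (suc n) (λ s → ∑-*ʳ (suc s) (d (n ∸ s)) (λ i → a i * b (s ∸ i))) ⟩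
    ∑ (suc n) (λ s → ∑ (suc s) (λ i → a i * b (s ∸ i) * d (n ∸ s)))
      ≈⟨ ∑-cong< (suc n) (λ s s≤n → ∑-cong< (suc s) (λ i i≤s → *-cong refl (reflexive (P.cong d (∸-split (ℕ.≤-pred i≤s)))))) ⟩
    ∑ (suc n) (λ s → ∑ (suc s) (λ i → a i * b (s ∸ i) * d (n ∸ i ∸ (s ∸ i))))
      ≈⟨ ∑-triangle n (λ i j → a i * b j * d (n ∸ i ∸ j)) ⟩
    ∑ (suc n) (λ i → ∑ (suc (n ∸ i)) (λ j → a i * b j * d (n ∸ i ∸ j)))
      ≈⟨ ∑-cong (suc n) (λ i → trans (∑-cong (suc (n ∸ i)) (λ j → *-assoc (a i) (b j) (d (n ∸ i ∸ j)))) (sym (∑-*ˡ (suc (n ∸ i)) (a i) _))) ⟩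
    ∑ (suc n) (λ i → a i * conv b d (n ∸ i)) ∎
    where
    ∸-split : ∀ {s i} → i ≤ s → n ∸ s ≡ n ∸ i ∸ (s ∸ i)
    ∸-split {s} {i} i≤s = P.trans (P.cong (n ∸_) (P.sym (ℕ.m+[n∸m]≡n i≤s))) (P.sym (ℕ.∸-+-assoc n i (s ∸ i)))

  conv-distribʳ : ∀ a b d → conv (a ⊞ b) d ≋ (conv a d ⊞ conv b d)
  conv-distribʳ a b d n = trans (∑-cong (suc n) (λ i → distribʳ (d (n ∸ i)) (a i) (b i))) (∑-+ (suc n) _ _)

  conv-•ˡ : ∀ x a b → conv (x • a) b ≋ (x • conv a b)
  conv-•ˡ x a b n = trans (∑-cong (suc n) (λ i → *-assoc x (a i) (b (n ∸ i)))) (sym (∑-*ˡ (suc n) x _))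

  conv-•ʳ : ∀ x a b → conv a (x • b) ≋ (x • conv a b)
  conv-•ʳ x a b n = trans (∑-cong (suc n) (λ i → x∙yz≈y∙xz (a i) x (b (n ∸ i)))) (sym (∑-*ˡ (suc n) x _))

  conv-∑ˢ : ∀ a m X → conv a (∑ˢ m X) ≋ ∑ˢ m (λ r → conv a (X r))
  conv-∑ˢ a m X n = begin
    ∑ (suc n) (λ i → a i * ∑ m (λ r → X r (n ∸ i)))   ≈⟨ ∑-cong (suc n) (λ i → ∑-*ˡ m (a i) (λ r → X r (n ∸ i))) ⟩
    ∑ (suc n) (λ i → ∑ m (λ r → a i * X r (n ∸ i)))   ≈⟨ ∑-comm (suc n) m (λ i r → a i * X r (n ∸ i)) ⟩
    ∑ m (λ r → conv a (X r) n)                        ∎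

  conv-identityˡ : ∀ a → conv 1ˢ a ≋ a
  conv-identityˡ a n = begin
    conv 1ˢ a n    ≈⟨ ∑-single (suc n) 0 (λ i → 1ˢ i * a (n ∸ i)) (s≤s z≤n) (λ { zero _ 0≢0 → ⊥-elim (0≢0 P.refl) ; (suc i) _ _ → zeroˡ _ }) ⟩
    1# * a n       ≈⟨ *-identityˡ _ ⟩
    a n            ∎

  conv-identityʳ : ∀ a → conv a 1ˢ ≋ a
  conv-identityʳ a n = trans (conv-comm a 1ˢ n) (conv-identityˡ a n)

  conv-zeroˡ : ∀ a → conv 0ˢ a ≋ 0ˢ
  conv-zeroˡ a n = ∑-≈0 (suc n) (λ i _ → zeroˡ _)

  powˢ : Series → ℕ → Series
  powˢ a zero    = 1ˢ
  powˢ a (suc k) = conv a (powˢ a k)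

  powˢ-+ : ∀ a j k → powˢ a (j ℕ.+ k) ≋ conv (powˢ a j) (powˢ a k)
  powˢ-+ a zero    k n = sym (conv-identityˡ (powˢ a k) n)
  powˢ-+ a (suc j) k n = begin
    conv a (powˢ a (j ℕ.+ k)) n                 ≈⟨ conv-cong {a} {a} {powˢ a (j ℕ.+ k)} {conv (powˢ a j) (powˢ a k)} (λ _ → refl) (powˢ-+ a j k) n ⟩
    conv a (conv (powˢ a j) (powˢ a k)) n       ≈⟨ sym (conv-assoc a (powˢ a j) (powˢ a k) n) ⟩
    conv (conv a (powˢ a j)) (powˢ a k) n       ∎

  powˢ-cong≤ : ∀ {a b} n k → (∀ i → i ≤ n → a i ≈ b i) → ∀ i → i ≤ n → powˢ a k i ≈ powˢ b k i
  powˢ-cong≤ n zero a≈b i i≤n = refl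
  powˢ-cong≤ {a} {b} n (suc k) a≈b i i≤n =
    conv-cong≤ {a} {b} {powˢ a k} {powˢ b k} i (λ j j≤i → a≈b j (ℕ.≤-trans j≤i i≤n)) (λ j j≤i → powˢ-cong≤ n k a≈b j (ℕ.≤-trans j≤i i≤n))

  powˢ-vanish : ∀ a → a 0 ≈ 0# → ∀ k n → n < k → powˢ a k n ≈ 0#
  powˢ-vanish a a₀≈0 (suc k) n n<1+k = ∑-≈0 (suc n) term≈0
    where
    term≈0 : ∀ i → i < suc n → a i * powˢ a k (n ∸ i) ≈ 0#
    term≈0 zero    _   = trans (*-cong a₀≈0 refl) (zeroˡ _)
    term≈0 (suc j) j<n = trans (*-cong refl (powˢ-vanish a a₀≈0 k (n ∸ suc j) n∸1+j<k)) (zeroʳ _)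
      where
      n∸1+j<k : n ∸ suc j < k
      n∸1+j<k = ℕ.<-≤-trans (ℕ.∸-monoʳ-< {n} {suc j} {0} (s≤s z≤n) (ℕ.≤-pred j<n)) (ℕ.≤-pred n<1+k)

  shift : Series → Series
  shift a zero    = 0#
  shift a (suc n) = a n

  shift-cong : ∀ {a b} → a ≋ b → shift a ≋ shift b
  shift-cong a≋b zero    = refl
  shift-cong a≋b (suc n) = a≋b n

  conv-shiftˡ : ∀ a b → conv (shift a) b ≋ shift (conv a b)
  conv-shiftˡ a b zero    = trans (∑-one _) (zeroˡ _)
  conv-shiftˡ a b (suc n) = trans (∑-suc (suc n) _) (trans (+-cong (zeroˡ _) refl) (+-identityˡ _))

  conv-shiftʳ : ∀ a b → conv a (shift b) ≋ shift (conv a b)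
  conv-shiftʳ a b n = trans (conv-comm a (shift b) n) (trans (conv-shiftˡ b a n) (shift-cong (conv-comm b a) n))

  shiftⁿ : ℕ → Series → Series
  shiftⁿ zero    a = a
  shiftⁿ (suc k) a = shift (shiftⁿ k a)

  shiftⁿ-apply : ∀ k a n → k ≤ n → shiftⁿ k a n ≈ a (n ∸ k)
  shiftⁿ-apply zero    a n       _         = refl
  shiftⁿ-apply (suc k) a (suc n) (s≤s k≤n) = shiftⁿ-apply k a n k≤n

  conv-shiftⁿ : ∀ a k b → conv a (shiftⁿ k b) ≋ shiftⁿ k (conv a b)
  conv-shiftⁿ a zero    b n = refl
  conv-shiftⁿ a (suc k) b n = trans (conv-shiftʳ a (shiftⁿ k b) n) (shift-cong (conv-shiftⁿ a k b) n)

  powˢ-shift : ∀ a k → powˢ (shift a) k ≋ shiftⁿ k (powˢ a k)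
  powˢ-shift a zero    n = refl
  powˢ-shift a (suc k) n = begin
    conv (shift a) (powˢ (shift a) k) n       ≈⟨ conv-cong {shift a} {shift a} {powˢ (shift a) k} {shiftⁿ k (powˢ a k)} (λ _ → refl) (powˢ-shift a k) n ⟩
    conv (shift a) (shiftⁿ k (powˢ a k)) n    ≈⟨ conv-shiftˡ a (shiftⁿ k (powˢ a k)) n ⟩
    shift (conv a (shiftⁿ k (powˢ a k))) n    ≈⟨ shift-cong (conv-shiftⁿ a k (powˢ a k)) n ⟩
    shiftⁿ (suc k) (powˢ a (suc k)) n         ∎

  comp : Series → Series → Series
  comp a τ n = ∑ (suc n) (λ j → a j * powˢ τ j n)

  module _ (τ : Series) (τ₀≈0 : τ 0 ≈ 0#) where

    comp-extend : ∀ a i n → i ≤ n → comp a τ i ≈ ∑ (suc n) (λ p → a p * powˢ τ p i)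
    comp-extend a i n i≤n =
      sym (∑-extend (λ p → a p * powˢ τ p i) (s≤s i≤n) (λ p i<p _ → trans (*-cong refl (powˢ-vanish τ τ₀≈0 p i i<p)) (zeroʳ _)))

    private
      pairSum : Series → Series → ℕ → Carrier
      pairSum a b n = ∑ (suc n) (λ p → ∑ (suc n) (λ q → a p * b q * powˢ τ (p ℕ.+ q) n))

      comp-conv≈pairSum : ∀ a b n → comp (conv a b) τ n ≈ pairSum a b n
      comp-conv≈pairSum a b n = begin
        ∑ (suc n) (λ s → conv a b s * powˢ τ s n)
          ≈⟨ ∑-cong (suc n) (λ s → ∑-*ʳ (suc s) (powˢ τ s n) (λ p → a p * b (s ∸ p))) ⟩
        ∑ (suc n) (λ s → ∑ (suc s) (λ p → a p * b (s ∸ p) * powˢ τ s n))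
          ≈⟨ ∑-cong< (suc n) (λ s _ → ∑-cong< (suc s) (λ p p≤s → *-cong refl (reflexive (P.cong (λ t → powˢ τ t n) (P.sym (ℕ.m+[n∸m]≡n (ℕ.≤-pred p≤s))))))) ⟩
        ∑ (suc n) (λ s → ∑ (suc s) (λ p → G p (s ∸ p)))
          ≈⟨ ∑-triangle n G ⟩
        ∑ (suc n) (λ p → ∑ (suc (n ∸ p)) (G p))
          ≈⟨ ∑-cong< (suc n) (λ p p≤n → sym (∑-extend (G p) (s≤s (ℕ.m∸n≤m n p)) (λ q n∸p<q _ → G≈0 p q (ℕ.≤-pred p≤n) n∸p<q))) ⟩
        pairSum a b n ∎
        where
        G : ℕ → ℕ → Carrier
        G p q = a p * b q * powˢ τ (p ℕ.+ q) n
        G≈0 : ∀ p q → p ≤ n → suc (n ∸ p) ≤ q → G p q ≈ 0#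
        G≈0 p q p≤n n∸p<q = trans (*-cong refl (powˢ-vanish τ τ₀≈0 (p ℕ.+ q) n n<p+q)) (zeroʳ _)
          where
          n<p+q : n < p ℕ.+ q
          n<p+q = P.subst (_< p ℕ.+ q) (ℕ.m+[n∸m]≡n p≤n) (ℕ.+-monoʳ-< p n∸p<q)

      conv-comp≈pairSum : ∀ a b n → conv (comp a τ) (comp b τ) n ≈ pairSum a b n
      conv-comp≈pairSum a b n = begin
        ∑ (suc n) (λ i → comp a τ i * comp b τ (n ∸ i))
          ≈⟨ ∑-cong< (suc n) (λ i i≤n → *-cong (comp-extend a i n (ℕ.≤-pred i≤n)) (comp-extend b (n ∸ i) n (ℕ.m∸n≤m n i))) ⟩
        ∑ (suc n) (λ i → ∑ (suc n) (λ p → a p * powˢ τ p i) * ∑ (suc n) (λ q → b q * powˢ τ q (n ∸ i)))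
          ≈⟨ ∑-cong (suc n) (λ i → ∑-*-∑ (suc n) (suc n) _ _) ⟩
        ∑ (suc n) (λ i → ∑ (suc n) (λ p → ∑ (suc n) (λ q → (a p * powˢ τ p i) * (b q * powˢ τ q (n ∸ i)))))
          ≈⟨ trans (∑-comm (suc n) (suc n) _) (∑-cong (suc n) (λ p → ∑-comm (suc n) (suc n) _)) ⟩
        ∑ (suc n) (λ p → ∑ (suc n) (λ q → ∑ (suc n) (λ i → (a p * powˢ τ p i) * (b q * powˢ τ q (n ∸ i)))))
          ≈⟨ ∑-cong (suc n) (λ p → ∑-cong (suc n) (λ q → coefficient p q)) ⟩
        pairSum a b n ∎
        where
        coefficient : ∀ p q → ∑ (suc n) (λ i → (a p * powˢ τ p i) * (b q * powˢ τ q (n ∸ i))) ≈ a p * b q * powˢ τ (p ℕ.+ q) n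
        coefficient p q = begin
          ∑ (suc n) (λ i → (a p * powˢ τ p i) * (b q * powˢ τ q (n ∸ i)))   ≈⟨ ∑-cong (suc n) (λ i → interchange (a p) (powˢ τ p i) (b q) (powˢ τ q (n ∸ i))) ⟩
          ∑ (suc n) (λ i → (a p * b q) * (powˢ τ p i * powˢ τ q (n ∸ i)))   ≈⟨ sym (∑-*ˡ (suc n) (a p * b q) _) ⟩
          a p * b q * conv (powˢ τ p) (powˢ τ q) n                           ≈⟨ *-cong refl (sym (powˢ-+ τ p q n)) ⟩
          a p * b q * powˢ τ (p ℕ.+ q) n                                     ∎

    comp-conv : ∀ a b → comp (conv a b) τ ≋ conv (comp a τ) (comp b τ)
    comp-conv a b n = trans (comp-conv≈pairSum a b n) (sym (conv-comp≈pairSum a b n))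

    comp-1ˢ : comp 1ˢ τ ≋ 1ˢ
    comp-1ˢ n = trans (∑-suc n _) (trans (+-cong (*-identityˡ _) (∑-≈0 n (λ i _ → zeroˡ _))) (+-identityʳ _))

    comp-powˢ : ∀ a k → comp (powˢ a k) τ ≋ powˢ (comp a τ) k
    comp-powˢ a zero    = comp-1ˢ
    comp-powˢ a (suc k) n =
      trans (comp-conv a (powˢ a k) n) (conv-cong {comp a τ} {comp a τ} {comp (powˢ a k) τ} {powˢ (comp a τ) k} (λ _ → refl) (comp-powˢ a k) n)


module DividedPowers {c ℓ : Level} (F : Char0Field c ℓ) where

  open import Data.Nat as ℕ using (ℕ; zero; suc; _∸_; _≤_; _<_; z≤n; s≤s; _!)
  import Data.Nat.Properties as ℕ
  open import Data.Nat.Induction using (<-rec)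
  import Relation.Binary.PropositionalEquality as P
  open FieldFacts F public
  open PowerSeries commutativeRing public
  open import Algebra.Properties.Group +-group using () renaming (∙-cancelʳ to +-cancelʳ)

  dpow : Series → ℕ → Series
  dpow a k = ι⁻¹ (k !) • powˢ a k

  dpow-cong≤ : ∀ {a b} n k → (∀ i → i ≤ n → a i ≈ b i) → ∀ i → i ≤ n → dpow a k i ≈ dpow b k i
  dpow-cong≤ n k a≈b i i≤n = *-cong refl (powˢ-cong≤ n k a≈b i i≤n)

  dpow-zero : ∀ a → dpow a 0 ≋ 1ˢ
  dpow-zero a n = trans (*-cong (trans (⁻¹-cong (char0 0) ι1≈1) (⁻¹-unique (*-identityʳ 1#))) refl) (*-identityˡ _)

  dpow-vanish : ∀ a → a 0 ≈ 0# → ∀ k n → n < k → dpow a k n ≈ 0#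
  dpow-vanish a a₀≈0 k n n<k = trans (*-cong refl (powˢ-vanish a a₀≈0 k n n<k)) (zeroʳ _)

  dpow-suc : ∀ a k → (ι (suc k) • dpow a (suc k)) ≋ conv a (dpow a k)
  dpow-suc a k n = begin
    ι (suc k) * (ι⁻¹ (suc k !) * conv a (powˢ a k) n)                ≈⟨ *-cong refl (*-cong (ι⁻¹[suc-n!] k) refl) ⟩
    ι (suc k) * ((ι⁻¹ (suc k) * ι⁻¹ (k !)) * conv a (powˢ a k) n)    ≈⟨ trans (*-cong refl (*-assoc _ _ _)) (sym (*-assoc _ _ _)) ⟩
    (ι (suc k) * ι⁻¹ (suc k)) * (ι⁻¹ (k !) * conv a (powˢ a k) n)    ≈⟨ *-cong (ι*ι⁻¹ (suc k)) (sym (conv-•ʳ (ι⁻¹ (k !)) a (powˢ a k) n)) ⟩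
    1# * conv a (dpow a k) n                                         ≈⟨ *-identityˡ _ ⟩
    conv a (dpow a k) n                                              ∎

  conv-dpow-absorb : ∀ a r b → conv a (conv (dpow a r) b) ≋ (ι (suc r) • conv (dpow a (suc r)) b)
  conv-dpow-absorb a r b n = begin
    conv a (conv (dpow a r) b) n                  ≈⟨ sym (conv-assoc a (dpow a r) b n) ⟩
    conv (conv a (dpow a r)) b n                  ≈⟨ conv-cong {conv a (dpow a r)} {ι (suc r) • dpow a (suc r)} {b} {b} (λ m → sym (dpow-suc a r m)) (λ _ → refl) n ⟩
    conv (ι (suc r) • dpow a (suc r)) b n         ≈⟨ conv-•ˡ (ι (suc r)) (dpow a (suc r)) b n ⟩
    ι (suc r) * conv (dpow a (suc r)) b n         ∎

  ∑-weights-r+[k∸r] : ∀ k T → ∑ (suc k) (λ r → ι (suc r) * T (suc r)) + ∑ (suc k) (λ r → ι (suc k ∸ r) * T r) ≈ ι (suc k) * ∑ (suc (suc k)) T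
  ∑-weights-r+[k∸r] k T = begin
    ∑ (suc k) (λ r → ι (suc r) * T (suc r)) + ∑ (suc k) (λ r → ι (suc k ∸ r) * T r)
      ≈⟨ +-cong (sym dropFirst) (sym dropLast) ⟩
    ∑ (suc (suc k)) (λ s → ι s * T s) + ∑ (suc (suc k)) (λ s → ι (suc k ∸ s) * T s)
      ≈⟨ sym (∑-+ (suc (suc k)) _ _) ⟩
    ∑ (suc (suc k)) (λ s → ι s * T s + ι (suc k ∸ s) * T s)
      ≈⟨ ∑-cong< (suc (suc k)) (λ s s≤1+k → trans (sym (distribʳ (T s) (ι s) (ι (suc k ∸ s)))) (*-cong (ι[s+[k∸s]] (ℕ.≤-pred s≤1+k)) refl)) ⟩
    ∑ (suc (suc k)) (λ s → ι (suc k) * T s)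
      ≈⟨ sym (∑-*ˡ (suc (suc k)) (ι (suc k)) T) ⟩
    ι (suc k) * ∑ (suc (suc k)) T ∎
    where
    dropFirst : ∑ (suc (suc k)) (λ s → ι s * T s) ≈ ∑ (suc k) (λ r → ι (suc r) * T (suc r))
    dropFirst = trans (∑-suc (suc k) _) (trans (+-cong (zeroˡ _) refl) (+-identityˡ _))
    dropLast : ∑ (suc (suc k)) (λ s → ι (suc k ∸ s) * T s) ≈ ∑ (suc k) (λ r → ι (suc k ∸ r) * T r)
    dropLast = trans (∑-last (suc k) _) (trans (+-cong refl (trans (*-cong (reflexive (P.cong ι (ℕ.n∸n≡0 (suc k)))) refl) (zeroˡ _))) (+-identityʳ _))
    ι[s+[k∸s]] : ∀ {s} → s ≤ suc k → ι s + ι (suc k ∸ s) ≈ ι (suc k)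
    ι[s+[k∸s]] {s} s≤1+k = trans (sym (ι-+ s (suc k ∸ s))) (reflexive (P.cong ι (ℕ.m+[n∸m]≡n s≤1+k)))

  dpow-binomial : ∀ a b k → dpow (a ⊞ b) k ≋ ∑ˢ (suc k) (λ r → conv (dpow a r) (dpow b (k ∸ r)))
  dpow-binomial a b zero n = begin
    dpow (a ⊞ b) 0 n                ≈⟨ dpow-zero (a ⊞ b) n ⟩
    1ˢ n                            ≈⟨ sym (conv-identityˡ 1ˢ n) ⟩
    conv 1ˢ 1ˢ n                    ≈⟨ sym (conv-cong (dpow-zero a) (dpow-zero b) n) ⟩
    conv (dpow a 0) (dpow b 0) n    ≈⟨ sym (∑-one _) ⟩
    ∑ 1 (λ r → conv (dpow a r) (dpow b (0 ∸ r)) n) ∎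
  dpow-binomial a b (suc k) n = *-cancelˡ (char0 k) (begin
    ι (suc k) * dpow (a ⊞ b) (suc k) n
      ≈⟨ dpow-suc (a ⊞ b) k n ⟩
    conv (a ⊞ b) (dpow (a ⊞ b) k) n
      ≈⟨ conv-cong {a ⊞ b} {a ⊞ b} {dpow (a ⊞ b) k} {∑ˢ (suc k) U} (λ _ → refl) (dpow-binomial a b k) n ⟩
    conv (a ⊞ b) (∑ˢ (suc k) U) n
      ≈⟨ trans (conv-distribʳ a b (∑ˢ (suc k) U) n) (+-cong (conv-∑ˢ a (suc k) U n) (conv-∑ˢ b (suc k) U n)) ⟩
    ∑ (suc k) (λ r → conv a (U r) n) + ∑ (suc k) (λ r → conv b (U r) n)
      ≈⟨ +-cong (∑-cong (suc k) (λ r → conv-dpow-absorb a r (dpow b (k ∸ r)) n)) (∑-cong< (suc k) absorb-b) ⟩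
    ∑ (suc k) (λ r → ι (suc r) * T (suc r)) + ∑ (suc k) (λ r → ι (suc k ∸ r) * T r)
      ≈⟨ ∑-weights-r+[k∸r] k T ⟩
    ι (suc k) * ∑ (suc (suc k)) T ∎)
    where
    U : ℕ → Series
    U r = conv (dpow a r) (dpow b (k ∸ r))
    T : ℕ → Carrier
    T s = conv (dpow a s) (dpow b (suc k ∸ s)) n
    absorb-b : ∀ r → r < suc k → conv b (U r) n ≈ ι (suc k ∸ r) * T r
    absorb-b r r≤k = begin
      conv b (conv (dpow a r) (dpow b (k ∸ r))) n
        ≈⟨ trans (conv-comm b _ n) (conv-assoc (dpow a r) (dpow b (k ∸ r)) b n) ⟩
      conv (dpow a r) (conv (dpow b (k ∸ r)) b) n
        ≈⟨ conv-cong {dpow a r} {dpow a r} {conv (dpow b (k ∸ r)) b} {ι (suc (k ∸ r)) • dpow b (suc (k ∸ r))} (λ _ → refl)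
             (λ m → trans (conv-comm (dpow b (k ∸ r)) b m) (sym (dpow-suc b (k ∸ r) m))) n ⟩
      conv (dpow a r) (ι (suc (k ∸ r)) • dpow b (suc (k ∸ r))) n
        ≈⟨ conv-•ʳ (ι (suc (k ∸ r))) (dpow a r) (dpow b (suc (k ∸ r))) n ⟩
      ι (suc (k ∸ r)) * conv (dpow a r) (dpow b (suc (k ∸ r))) n
        ≈⟨ reflexive (P.cong (λ t → ι t * conv (dpow a r) (dpow b t) n) (P.sym (ℕ.+-∸-assoc 1 (ℕ.≤-pred r≤k)))) ⟩
      ι (suc k ∸ r) * T r ∎


  ∑-recurrence : ∀ m x (c c′ d : ℕ → Carrier) → c′ 0 ≈ x * c 0 → (∀ j → c′ (suc j) ≈ x * c (suc j) + ι (suc j) * c j) → d (suc m) ≈ 0# →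
    ∑ (suc m) (λ j → c j * (x * d j + ι (suc j) * d (suc j))) ≈ ∑ (suc m) (λ j → c′ j * d j)
  ∑-recurrence m x c c′ d c′₀ c′ₛ dₘ₊₁≈0 = begin
    ∑ (suc m) (λ j → c j * (x * d j + ι (suc j) * d (suc j)))
      ≈⟨ ∑-cong (suc m) (λ j → zsolve 5 (λ c x d i e → (c :* ((x :* d) :+ (i :* e))) := ((x :* (c :* d)) :+ ((i :* c) :* e))) refl (c j) x (d j) (ι (suc j)) (d (suc j))) ⟩
    ∑ (suc m) (λ j → x * (c j * d j) + (ι (suc j) * c j) * d (suc j))
      ≈⟨ ∑-+ (suc m) _ _ ⟩
    ∑ (suc m) (λ j → x * (c j * d j)) + ∑ (suc m) (λ j → (ι (suc j) * c j) * d (suc j))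
      ≈⟨ +-cong (∑-suc m _) (trans (∑-last m _) (trans (+-cong refl (trans (*-cong refl dₘ₊₁≈0) (zeroʳ _))) (+-identityʳ _))) ⟩
    (x * (c 0 * d 0) + ∑ m (λ j → x * (c (suc j) * d (suc j)))) + ∑ m (λ j → (ι (suc j) * c j) * d (suc j))
      ≈⟨ +-assoc _ _ _ ⟩
    x * (c 0 * d 0) + (∑ m (λ j → x * (c (suc j) * d (suc j))) + ∑ m (λ j → (ι (suc j) * c j) * d (suc j)))
      ≈⟨ +-cong (trans (sym (*-assoc _ _ _)) (*-cong (sym c′₀) refl)) (trans (sym (∑-+ m _ _)) (∑-cong m tail)) ⟩
    c′ 0 * d 0 + ∑ m (λ j → c′ (suc j) * d (suc j))
      ≈⟨ sym (∑-suc m _) ⟩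
    ∑ (suc m) (λ j → c′ j * d j) ∎
    where
    tail : ∀ j → x * (c (suc j) * d (suc j)) + (ι (suc j) * c j) * d (suc j) ≈ c′ (suc j) * d (suc j)
    tail j = trans (+-cong (sym (*-assoc _ _ _)) refl) (trans (sym (distribʳ _ _ _)) (*-cong (sym (c′ₛ j)) refl))

  conv-cancelˡ : ∀ a {b b′} → ¬ (a 0 ≈ 0#) → conv a b ≋ conv a b′ → b ≋ b′
  conv-cancelˡ a {b} {b′} a₀≉0 ab≋ab′ = <-rec (λ n → b n ≈ b′ n) step
    where
    step : ∀ n → (∀ {m} → m < n → b m ≈ b′ m) → b n ≈ b′ n
    step n ih = *-cancelˡ a₀≉0 (+-cancelʳ rest (a 0 * b n) (a 0 * b′ n) (begin
      a 0 * b n + rest                                    ≈⟨ sym (∑-suc n _) ⟩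
      conv a b n                                          ≈⟨ ab≋ab′ n ⟩
      conv a b′ n                                         ≈⟨ ∑-suc n _ ⟩
      a 0 * b′ n + ∑ n (λ i → a (suc i) * b′ (n ∸ suc i))  ≈⟨ +-cong refl (∑-cong< n (λ i i<n → *-cong refl (sym (ih (ℕ.∸-monoʳ-< {n} {suc i} {0} (s≤s z≤n) i<n))))) ⟩
      a 0 * b′ n + rest                                   ∎))
      where
      rest = ∑ n (λ i → a (suc i) * b (n ∸ suc i))

  θ : Series → Series
  θ a n = ι n * a n

  θ-conv : ∀ a b → θ (conv a b) ≋ (conv (θ a) b ⊞ conv a (θ b))
  θ-conv a b n = begin
    ι n * ∑ (suc n) (λ i → a i * b (n ∸ i))                 ≈⟨ ∑-*ˡ (suc n) (ι n) _ ⟩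
    ∑ (suc n) (λ i → ι n * (a i * b (n ∸ i)))
      ≈⟨ ∑-cong< (suc n) (λ i i≤n → trans (*-cong (ι[i+[n∸i]] (ℕ.≤-pred i≤n)) refl) (leibniz (ι i) (ι (n ∸ i)) (a i) (b (n ∸ i)))) ⟩
    ∑ (suc n) (λ i → θ a i * b (n ∸ i) + a i * θ b (n ∸ i)) ≈⟨ ∑-+ (suc n) _ _ ⟩
    conv (θ a) b n + conv a (θ b) n                         ∎
    where
    ι[i+[n∸i]] : ∀ {i} → i ≤ n → ι n ≈ ι i + ι (n ∸ i)
    ι[i+[n∸i]] {i} i≤n = trans (reflexive (P.cong ι (P.sym (ℕ.m+[n∸m]≡n i≤n)))) (ι-+ i (n ∸ i))
    leibniz : ∀ p q u v → (p + q) * (u * v) ≈ (p * u) * v + u * (q * v)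
    leibniz = zsolve 4 (λ p q u v → ((p :+ q) :* (u :* v)) := (((p :* u) :* v) :+ (u :* (q :* v)))) refl

  θ-• : ∀ x a → θ (x • a) ≋ (x • θ a)
  θ-• x a n = zsolve 3 (λ i x a → (i :* (x :* a)) := (x :* (i :* a))) refl (ι n) x (a n)

  θ-dpow-zero : ∀ a → θ (dpow a 0) ≋ 0ˢ
  θ-dpow-zero a zero    = zeroˡ _
  θ-dpow-zero a (suc n) = trans (*-cong refl (dpow-zero a (suc n))) (zeroʳ _)

  θ-dpow-suc : ∀ a j → θ (dpow a (suc j)) ≋ conv (θ a) (dpow a j)
  θ-dpow-suc a j n = *-cancelˡ (char0 j) (begin
    ι (suc j) * θ (dpow a (suc j)) n                          ≈⟨ sym (θ-• (ι (suc j)) (dpow a (suc j)) n) ⟩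
    ι n * (ι (suc j) * dpow a (suc j) n)                       ≈⟨ *-cong refl (dpow-suc a j n) ⟩
    θ (conv a (dpow a j)) n                                    ≈⟨ θ-conv a (dpow a j) n ⟩
    conv (θ a) (dpow a j) n + conv a (θ (dpow a j)) n          ≈⟨ +-cong refl (conv-θ-dpow j) ⟩
    conv (θ a) (dpow a j) n + ι j * conv (θ a) (dpow a j) n    ≈⟨ sym (trans (distribʳ _ _ _) (+-cong (*-identityˡ _) refl)) ⟩
    ι (suc j) * conv (θ a) (dpow a j) n                        ∎)
    where
    conv-θ-dpow : ∀ j → conv a (θ (dpow a j)) n ≈ ι j * conv (θ a) (dpow a j) n
    conv-θ-dpow zero = begin
      conv a (θ (dpow a 0)) n   ≈⟨ conv-cong {a} {a} {θ (dpow a 0)} {0ˢ} (λ _ → refl) (θ-dpow-zero a) n ⟩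
      conv a 0ˢ n               ≈⟨ trans (conv-comm a 0ˢ n) (conv-zeroˡ a n) ⟩
      0#                        ≈⟨ sym (zeroˡ _) ⟩
      ι 0 * conv (θ a) (dpow a 0) n ∎
    conv-θ-dpow (suc j) = begin
      conv a (θ (dpow a (suc j))) n                  ≈⟨ conv-cong {a} {a} {θ (dpow a (suc j))} {conv (θ a) (dpow a j)} (λ _ → refl) (θ-dpow-suc a j) n ⟩
      conv a (conv (θ a) (dpow a j)) n               ≈⟨ sym (conv-assoc a (θ a) (dpow a j) n) ⟩
      conv (conv a (θ a)) (dpow a j) n               ≈⟨ conv-cong {conv a (θ a)} {conv (θ a) a} {dpow a j} {dpow a j} (conv-comm a (θ a)) (λ _ → refl) n ⟩
      conv (conv (θ a) a) (dpow a j) n               ≈⟨ conv-assoc (θ a) a (dpow a j) n ⟩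
      conv (θ a) (conv a (dpow a j)) n               ≈⟨ conv-cong {θ a} {θ a} {conv a (dpow a j)} {ι (suc j) • dpow a (suc j)} (λ _ → refl) (λ k → sym (dpow-suc a j k)) n ⟩
      conv (θ a) (ι (suc j) • dpow a (suc j)) n      ≈⟨ conv-•ʳ (ι (suc j)) (θ a) (dpow a (suc j)) n ⟩
      ι (suc j) * conv (θ a) (dpow a (suc j)) n      ∎

module BellPolynomials {c ℓ : Level} (F : Char0Field c ℓ) where

  open import Data.Nat as ℕ using (ℕ; zero; suc; _∸_; _≤_; _<_; z≤n; s≤s; _!)
  import Data.Nat.Properties as ℕ
  open import Data.Nat.Divisibility using (_∣_)
  open import Data.Nat.DivMod using (_/_; m/n*n≡m)
  open import Data.List using (List; []; _∷_; map; applyUpTo; upTo; filter; concatMap; _++_)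
  open import Data.Vec using (Vec; []; _∷_)
  open import Data.Bool using (true; false; T; if_then_else_)
  open import Data.Empty using (⊥-elim)
  open import Relation.Nullary using (Dec; yes; no)
  open import Relation.Nullary.Decidable using (_×-dec_)
  open import Relation.Binary.PropositionalEquality as P using (_≡_)
  open Factorials using (den∣wsum!)
  open DividedPowers F public

  𝟙 : ∀ {p} {A : Set p} → Dec A → Carrier
  𝟙 (yes _) = 1#
  𝟙 (no _)  = 0#

  𝟙-yes : ∀ {p} {A : Set p} (d : Dec A) → A → 𝟙 d ≈ 1#
  𝟙-yes (yes _) a = refl
  𝟙-yes (no ¬a) a = ⊥-elim (¬a a)

  𝟙-no : ∀ {p} {A : Set p} (d : Dec A) → ¬ A → 𝟙 d ≈ 0#
  𝟙-no (yes a) ¬a = ⊥-elim (¬a a)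
  𝟙-no (no _)  ¬a = refl

  𝟙-sym : ∀ a b → 𝟙 (a ℕ.≟ b) ≈ 𝟙 (b ℕ.≟ a)
  𝟙-sym a b with a ℕ.≟ b | b ℕ.≟ a
  ... | yes _   | yes _   = refl
  ... | no _    | no _    = refl
  ... | yes a≡b | no b≢a  = ⊥-elim (b≢a (P.sym a≡b))
  ... | no a≢b  | yes b≡a = ⊥-elim (a≢b (P.sym b≡a))

  𝟙-+ : ∀ r s k → 𝟙 (r ℕ.+ s ℕ.≟ k) ≈ 𝟙 (r ℕ.≤? k) * 𝟙 (s ℕ.≟ k ∸ r)
  𝟙-+ r s k with r ℕ.+ s ℕ.≟ k | r ℕ.≤? k | s ℕ.≟ k ∸ r
  ... | yes _   | yes _   | yes _   = sym (*-identityʳ 1#)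
  ... | yes r+s≡k | no r≰k | _     = ⊥-elim (r≰k (P.subst (r ≤_) r+s≡k (ℕ.m≤m+n r s)))
  ... | yes r+s≡k | yes _ | no s≢k∸r = ⊥-elim (s≢k∸r (P.trans (P.sym (ℕ.m+n∸m≡n r s)) (P.cong (_∸ r) r+s≡k)))
  ... | no r+s≢k | yes r≤k | yes s≡k∸r = ⊥-elim (r+s≢k (P.trans (P.cong (r ℕ.+_) s≡k∸r) (ℕ.m+[n∸m]≡n r≤k)))
  ... | no _    | yes _   | no _    = sym (zeroʳ 1#)
  ... | no _    | no _    | yes _   = sym (zeroˡ 1#)
  ... | no _    | no _    | no _    = sym (zeroˡ 0#)

  ∑ᴸ : ∀ {a} {A : Set a} → List A → (A → Carrier) → Carrier
  ∑ᴸ xs G = sumL (map G xs)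

  ∑ᴸ-cong : ∀ {a} {A : Set a} (xs : List A) {G H : A → Carrier} → (∀ x → G x ≈ H x) → ∑ᴸ xs G ≈ ∑ᴸ xs H
  ∑ᴸ-cong []       G≈H = refl
  ∑ᴸ-cong (x ∷ xs) G≈H = +-cong (G≈H x) (∑ᴸ-cong xs G≈H)

  ∑ᴸ-*ˡ : ∀ {a} {A : Set a} (xs : List A) (k : Carrier) (G : A → Carrier) → k * ∑ᴸ xs G ≈ ∑ᴸ xs (λ x → k * G x)
  ∑ᴸ-*ˡ []       k G = zeroʳ k
  ∑ᴸ-*ˡ (x ∷ xs) k G = trans (distribˡ k _ _) (+-cong refl (∑ᴸ-*ˡ xs k G))

  ∑ᴸ-∑ : ∀ {a} {A : Set a} (xs : List A) m (H : A → ℕ → Carrier) → ∑ᴸ xs (λ x → ∑ m (H x)) ≈ ∑ m (λ r → ∑ᴸ xs (λ x → H x r))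
  ∑ᴸ-∑ []       m H = sym (∑-≈0 m (λ _ _ → refl))
  ∑ᴸ-∑ (x ∷ xs) m H = trans (+-cong refl (∑ᴸ-∑ xs m H)) (sym (∑-+ m (H x) (λ r → ∑ᴸ xs (λ y → H y r))))

  ∑ᴸ-++ : ∀ {a} {A : Set a} (xs ys : List A) (G : A → Carrier) → ∑ᴸ (xs ++ ys) G ≈ ∑ᴸ xs G + ∑ᴸ ys G
  ∑ᴸ-++ []       ys G = sym (+-identityˡ _)
  ∑ᴸ-++ (x ∷ xs) ys G = trans (+-cong refl (∑ᴸ-++ xs ys G)) (sym (+-assoc _ _ _))

  ∑ᴸ-concatMap : ∀ {a b} {A : Set a} {B : Set b} (h : A → List B) (xs : List A) (G : B → Carrier) →
    ∑ᴸ (concatMap h xs) G ≈ ∑ᴸ xs (λ x → ∑ᴸ (h x) G)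
  ∑ᴸ-concatMap h []       G = refl
  ∑ᴸ-concatMap h (x ∷ xs) G = trans (∑ᴸ-++ (h x) (concatMap h xs) G) (+-cong refl (∑ᴸ-concatMap h xs G))

  ∑ᴸ-map : ∀ {a b} {A : Set a} {B : Set b} (h : A → B) (xs : List A) (G : B → Carrier) → ∑ᴸ (map h xs) G ≈ ∑ᴸ xs (λ x → G (h x))
  ∑ᴸ-map h []       G = refl
  ∑ᴸ-map h (x ∷ xs) G = +-cong refl (∑ᴸ-map h xs G)

  ∑ᴸ-filter : ∀ {a p} {A : Set a} {P : A → Set p} (P? : ∀ x → Dec (P x)) (xs : List A) (G : A → Carrier) →
    ∑ᴸ (filter P? xs) G ≈ ∑ᴸ xs (λ x → 𝟙 (P? x) * G x)
  ∑ᴸ-filter P? []       G = refl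
  ∑ᴸ-filter P? (x ∷ xs) G with P? x
  ... | yes _ = +-cong (sym (*-identityˡ _)) (∑ᴸ-filter P? xs G)
  ... | no _  = trans (∑ᴸ-filter P? xs G) (sym (trans (+-cong (zeroˡ _) refl) (+-identityˡ _)))

  ∑ᴸ-applyUpTo : ∀ (G : ℕ → Carrier) h n → ∑ᴸ (applyUpTo h n) G ≈ ∑ n (λ i → G (h i))
  ∑ᴸ-applyUpTo G h zero    = sym (∑-zero _)
  ∑ᴸ-applyUpTo G h (suc n) = trans (+-cong refl (∑ᴸ-applyUpTo G (λ i → h (suc i)) n)) (sym (∑-suc n _))

  sumFromTo≈∑ : ∀ a b f → sumFromTo a b f ≈ ∑ (suc b ∸ a) (λ t → f (a ℕ.+ t))
  sumFromTo≈∑ a b f = ∑ᴸ-applyUpTo (λ t → f (a ℕ.+ t)) (λ i → i) (suc b ∸ a)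

  sumFromTo[a,a+t]≈∑ : ∀ a t f → sumFromTo a (a ℕ.+ t) f ≈ ∑ (suc t) (λ u → f (a ℕ.+ u))
  sumFromTo[a,a+t]≈∑ a t f = trans (sumFromTo≈∑ a (a ℕ.+ t) f) (∑-≡ _ (P.trans (ℕ.+-∸-assoc 1 (ℕ.m≤m+n a t)) (P.cong suc (ℕ.m+n∸m≡n a t))))

  monomial : Carrier → ℕ → Series
  monomial x d n = 𝟙 (n ℕ.≟ d) * x

  monomial-off : ∀ x d i → ¬ (i ≡ d) → monomial x d i ≈ 0#
  monomial-off x d i i≢d = trans (*-cong (𝟙-no (i ℕ.≟ d) i≢d) refl) (zeroˡ x)

  conv-monomial : ∀ x d b n → conv (monomial x d) b n ≈ 𝟙 (d ℕ.≤? n) * (x * b (n ∸ d))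
  conv-monomial x d b n with d ℕ.≤? n
  ... | yes d≤n = begin
    conv (monomial x d) b n     ≈⟨ ∑-single (suc n) d _ (s≤s d≤n) (λ i _ i≢d → trans (*-cong (monomial-off x d i i≢d) refl) (zeroˡ _)) ⟩
    monomial x d d * b (n ∸ d)  ≈⟨ *-cong (trans (*-cong (𝟙-yes (d ℕ.≟ d) P.refl) refl) (*-identityˡ x)) refl ⟩
    x * b (n ∸ d)               ≈⟨ sym (*-identityˡ _) ⟩
    1# * (x * b (n ∸ d))        ∎
  ... | no d≰n = trans (∑-≈0 (suc n) term≈0) (sym (zeroˡ _))
    where
    term≈0 : ∀ i → i < suc n → monomial x d i * b (n ∸ i) ≈ 0#
    term≈0 i i≤n = trans (*-cong (monomial-off x d i (λ i≡d → d≰n (P.subst (_≤ n) i≡d (ℕ.≤-pred i≤n)))) refl) (zeroˡ _)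

  powˢ-monomial : ∀ x d r → powˢ (monomial x d) r ≋ monomial (pow x r) (d ℕ.* r)
  powˢ-monomial x d zero n = trans (1ˢ≈ n) (reflexive (P.cong (λ t → 𝟙 (n ℕ.≟ t) * 1#) (P.sym (ℕ.*-zeroʳ d))))
    where
    1ˢ≈ : ∀ n → 1ˢ n ≈ 𝟙 (n ℕ.≟ 0) * 1#
    1ˢ≈ zero    = sym (*-identityʳ 1#)
    1ˢ≈ (suc n) = sym (zeroˡ 1#)
  powˢ-monomial x d (suc r) n = begin
    conv (monomial x d) (powˢ (monomial x d) r) n
      ≈⟨ conv-cong {monomial x d} {monomial x d} {powˢ (monomial x d) r} {monomial (pow x r) (d ℕ.* r)} (λ _ → refl) (powˢ-monomial x d r) n ⟩
    conv (monomial x d) (monomial (pow x r) (d ℕ.* r)) n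
      ≈⟨ conv-monomial x d (monomial (pow x r) (d ℕ.* r)) n ⟩
    𝟙 (d ℕ.≤? n) * (x * (𝟙 (n ∸ d ℕ.≟ d ℕ.* r) * pow x r))
      ≈⟨ zsolve 4 (λ a b y z → (a :* (y :* (b :* z))) := ((a :* b) :* (y :* z))) refl (𝟙 (d ℕ.≤? n)) (𝟙 (n ∸ d ℕ.≟ d ℕ.* r)) x (pow x r) ⟩
    (𝟙 (d ℕ.≤? n) * 𝟙 (n ∸ d ℕ.≟ d ℕ.* r)) * pow x (suc r)
      ≈⟨ *-cong (trans (*-cong refl (𝟙-sym (n ∸ d) (d ℕ.* r))) (sym (𝟙-+ d (d ℕ.* r) n))) refl ⟩
    𝟙 (d ℕ.+ d ℕ.* r ℕ.≟ n) * pow x (suc r)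
      ≈⟨ *-cong (trans (𝟙-sym _ n) (reflexive (P.cong (λ t → 𝟙 (n ℕ.≟ t)) (P.sym (ℕ.*-suc d r))))) refl ⟩
    𝟙 (n ℕ.≟ d ℕ.* suc r) * pow x (suc r) ∎

  conv-dpow-monomial : ∀ x d r b n → conv (dpow (monomial x d) r) b n ≈ 𝟙 (d ℕ.* r ℕ.≤? n) * ((ι⁻¹ (r !) * pow x r) * b (n ∸ d ℕ.* r))
  conv-dpow-monomial x d r b n = begin
    conv (ι⁻¹ (r !) • powˢ (monomial x d) r) b n
      ≈⟨ conv-•ˡ (ι⁻¹ (r !)) (powˢ (monomial x d) r) b n ⟩
    ι⁻¹ (r !) * conv (powˢ (monomial x d) r) b n
      ≈⟨ *-cong refl (conv-cong {powˢ (monomial x d) r} {monomial (pow x r) (d ℕ.* r)} {b} {b} (powˢ-monomial x d r) (λ _ → refl) n) ⟩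
    ι⁻¹ (r !) * conv (monomial (pow x r) (d ℕ.* r)) b n
      ≈⟨ *-cong refl (conv-monomial (pow x r) (d ℕ.* r) b n) ⟩
    ι⁻¹ (r !) * (𝟙 (d ℕ.* r ℕ.≤? n) * (pow x r * b (n ∸ d ℕ.* r)))
      ≈⟨ zsolve 4 (λ a e y z → (a :* (e :* (y :* z))) := (e :* ((a :* y) :* z))) refl (ι⁻¹ (r !)) (𝟙 (d ℕ.* r ℕ.≤? n)) (pow x r) (b (n ∸ d ℕ.* r)) ⟩
    𝟙 (d ℕ.* r ℕ.≤? n) * ((ι⁻¹ (r !) * pow x r) * b (n ∸ d ℕ.* r)) ∎

  window : Series → ℕ → ℕ → Series
  window f i zero    = 0ˢ
  window f i (suc l) = monomial (f i) i ⊞ window f (suc i) l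

  window-below : ∀ f l i j → j < i → window f i l j ≈ 0#
  window-below f zero    i j j<i = refl
  window-below f (suc l) i j j<i =
    trans (+-cong (monomial-off (f i) i j (ℕ.<⇒≢ j<i)) (window-below f l (suc i) j (ℕ.m<n⇒m<1+n j<i))) (+-identityˡ _)

  window-inside : ∀ f l i j → i ≤ j → j < i ℕ.+ l → window f i l j ≈ f j
  window-inside f zero    i j i≤j j<i+0 = ⊥-elim (ℕ.<⇒≱ j<i+0 (P.subst (_≤ j) (P.sym (ℕ.+-identityʳ i)) i≤j))
  window-inside f (suc l) i j i≤j j<i+1+l with j ℕ.≟ i
  ... | yes P.refl = trans (+-cong (*-identityˡ _) (window-below f l (suc j) j (ℕ.n<1+n j))) (+-identityʳ _)
  ... | no j≢i     = trans (+-cong (zeroˡ _) (window-inside f l (suc i) j (ℕ.≤∧≢⇒< i≤j (λ i≡j → j≢i (P.sym i≡j))) (P.subst (j <_) (ℕ.+-suc i l) j<i+1+l))) (+-identityˡ _)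

  weight : Series → ∀ {l} → ℕ → Vec ℕ l → Carrier
  weight f i []       = 1#
  weight f i (r ∷ rs) = (pow (f i) r * ι⁻¹ (r !)) * weight f (suc i) rs

  bellSummand : Series → ℕ → ℕ → ℕ → ∀ {l} → Vec ℕ l → Carrier
  bellSummand f i n k rs = 𝟙 (vsum rs ℕ.≟ k) * (𝟙 (wsum i rs ℕ.≟ n) * weight f i rs)

  bellSum : Series → ℕ → ℕ → ℕ → ℕ → ℕ → Carrier
  bellSum f i l b n k = ∑ᴸ (vecsUpTo l b) (bellSummand f i n k)

  headFactor : Series → ℕ → ℕ → ℕ → ℕ → Carrier
  headFactor f i n k r = (𝟙 (r ℕ.≤? k) * 𝟙 (i ℕ.* r ℕ.≤? n)) * (pow (f i) r * ι⁻¹ (r !))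

  bellSummand-∷ : ∀ f i n k r {l} (v : Vec ℕ l) →
    bellSummand f i n k (r ∷ v) ≈ headFactor f i n k r * bellSummand f (suc i) (n ∸ i ℕ.* r) (k ∸ r) v
  bellSummand-∷ f i n k r v = begin
    𝟙 (r ℕ.+ vsum v ℕ.≟ k) * (𝟙 (i ℕ.* r ℕ.+ wsum (suc i) v ℕ.≟ n) * (a * w))
      ≈⟨ *-cong (𝟙-+ r (vsum v) k) (*-cong (𝟙-+ (i ℕ.* r) (wsum (suc i) v) n) refl) ⟩
    (A * B) * ((C′ * D) * (a * w))
      ≈⟨ zsolve 6 (λ A B C′ D a w → ((A :* B) :* ((C′ :* D) :* (a :* w))) := (((A :* C′) :* a) :* (B :* (D :* w)))) refl A B C′ D a w ⟩
    ((A * C′) * a) * (B * (D * w)) ∎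
    where
    A  = 𝟙 (r ℕ.≤? k)
    B  = 𝟙 (vsum v ℕ.≟ k ∸ r)
    C′ = 𝟙 (i ℕ.* r ℕ.≤? n)
    D  = 𝟙 (wsum (suc i) v ℕ.≟ n ∸ i ℕ.* r)
    a  = pow (f i) r * ι⁻¹ (r !)
    w  = weight f (suc i) v

  bellSum-suc : ∀ f i l b n k →
    bellSum f i (suc l) b n k ≈ ∑ (suc b) (λ r → headFactor f i n k r * bellSum f (suc i) l b (n ∸ i ℕ.* r) (k ∸ r))
  bellSum-suc f i l b n k = begin
    ∑ᴸ (concatMap (λ v → map (_∷ v) (upTo (suc b))) V) G
      ≈⟨ ∑ᴸ-concatMap (λ v → map (_∷ v) (upTo (suc b))) V G ⟩
    ∑ᴸ V (λ v → ∑ᴸ (map (_∷ v) (upTo (suc b))) G)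
      ≈⟨ ∑ᴸ-cong V (λ v → trans (∑ᴸ-map (_∷ v) (upTo (suc b)) G) (∑ᴸ-applyUpTo (λ r → G (r ∷ v)) (λ i → i) (suc b))) ⟩
    ∑ᴸ V (λ v → ∑ (suc b) (λ r → G (r ∷ v)))
      ≈⟨ ∑ᴸ-∑ V (suc b) (λ v r → G (r ∷ v)) ⟩
    ∑ (suc b) (λ r → ∑ᴸ V (λ v → G (r ∷ v)))
      ≈⟨ ∑-cong (suc b) (λ r → trans (∑ᴸ-cong V (bellSummand-∷ f i n k r)) (sym (∑ᴸ-*ˡ V (headFactor f i n k r) _))) ⟩
    ∑ (suc b) (λ r → headFactor f i n k r * bellSum f (suc i) l b (n ∸ i ℕ.* r) (k ∸ r)) ∎
    where
    V = vecsUpTo l b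
    G = bellSummand f i n k

  dpow-0ˢ : ∀ k n → dpow 0ˢ k n ≈ 𝟙 (0 ℕ.≟ k) * 𝟙 (0 ℕ.≟ n)
  dpow-0ˢ zero    zero    = trans (dpow-zero 0ˢ 0) (sym (*-identityˡ _))
  dpow-0ˢ zero    (suc n) = trans (dpow-zero 0ˢ (suc n)) (sym (zeroʳ _))
  dpow-0ˢ (suc k) n       = trans (*-cong refl (conv-zeroˡ (powˢ 0ˢ k) n)) (trans (zeroʳ _) (sym (zeroˡ _)))

  bellSum≈dpow : ∀ f l i b n k → k ≤ b → bellSum f i l b n k ≈ dpow (window f i l) k n
  bellSum≈dpow f zero i b n k k≤b = begin
    𝟙 (0 ℕ.≟ k) * (𝟙 (0 ℕ.≟ n) * 1#) + 0#   ≈⟨ trans (+-identityʳ _) (*-cong refl (*-identityʳ _)) ⟩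
    𝟙 (0 ℕ.≟ k) * 𝟙 (0 ℕ.≟ n)               ≈⟨ sym (dpow-0ˢ k n) ⟩
    dpow 0ˢ k n                              ∎
  bellSum≈dpow f (suc l) i b n k k≤b = begin
    bellSum f i (suc l) b n k
      ≈⟨ bellSum-suc f i l b n k ⟩
    ∑ (suc b) (λ r → headFactor f i n k r * bellSum f (suc i) l b (n ∸ i ℕ.* r) (k ∸ r))
      ≈⟨ ∑-extend _ (s≤s k≤b) (λ r k<r _ → trans (*-cong (trans (*-cong (trans (*-cong (𝟙-no (r ℕ.≤? k) (ℕ.<⇒≱ k<r)) refl) (zeroˡ _)) refl) (zeroˡ _)) refl) (zeroˡ _)) ⟩
    ∑ (suc k) (λ r → headFactor f i n k r * bellSum f (suc i) l b (n ∸ i ℕ.* r) (k ∸ r))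
      ≈⟨ ∑-cong< (suc k) term ⟩
    ∑ (suc k) (λ r → conv (dpow (monomial (f i) i) r) (dpow rest (k ∸ r)) n)
      ≈⟨ sym (dpow-binomial (monomial (f i) i) rest k n) ⟩
    dpow (window f i (suc l)) k n ∎
    where
    rest = window f (suc i) l
    term : ∀ r → r < suc k → headFactor f i n k r * bellSum f (suc i) l b (n ∸ i ℕ.* r) (k ∸ r) ≈ conv (dpow (monomial (f i) i) r) (dpow rest (k ∸ r)) n
    term r r≤k = begin
      ((𝟙 (r ℕ.≤? k) * 𝟙 (i ℕ.* r ℕ.≤? n)) * (pow (f i) r * ι⁻¹ (r !))) * bellSum f (suc i) l b (n ∸ i ℕ.* r) (k ∸ r)
        ≈⟨ *-cong (*-cong (trans (*-cong (𝟙-yes (r ℕ.≤? k) (ℕ.≤-pred r≤k)) refl) (*-identityˡ _)) (*-comm _ _))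
                  (bellSum≈dpow f l (suc i) b (n ∸ i ℕ.* r) (k ∸ r) (ℕ.≤-trans (ℕ.m∸n≤m k r) k≤b)) ⟩
      (𝟙 (i ℕ.* r ℕ.≤? n) * (ι⁻¹ (r !) * pow (f i) r)) * dpow rest (k ∸ r) (n ∸ i ℕ.* r)
        ≈⟨ *-assoc _ _ _ ⟩
      𝟙 (i ℕ.* r ℕ.≤? n) * ((ι⁻¹ (r !) * pow (f i) r) * dpow rest (k ∸ r) (n ∸ i ℕ.* r))
        ≈⟨ sym (conv-dpow-monomial (f i) i r (dpow rest (k ∸ r)) n) ⟩
      conv (dpow (monomial (f i) i) r) (dpow rest (k ∸ r)) n ∎

  egf : Val → Series
  egf y zero    = 0#
  egf y (suc j) = y (suc j) * ι⁻¹ (suc j !)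

  window≈egf : ∀ y n j → j ≤ n → window (egf y) 1 n j ≈ egf y j
  window≈egf y n zero    _   = window-below (egf y) n 1 0 (s≤s z≤n)
  window≈egf y n (suc j) j<n = window-inside (egf y) n 1 (suc j) (s≤s z≤n) (s≤s j<n)

  ι[den]≉0 : ∀ {l} i (rs : Vec ℕ l) → ¬ (ι (den i rs) ≈ 0#)
  ι[den]≉0 i rs = ι-nonZero (den i rs) {{den-nz i rs}}

  mono*ι⁻¹[den]≈weight : ∀ y {l} i (rs : Vec ℕ l) → mono y (suc i) rs * (ι (den (suc i) rs)) ⁻¹ ≈ weight (egf y) (suc i) rs
  mono*ι⁻¹[den]≈weight y i []       = trans (*-identityˡ _) (⁻¹-unique (trans (*-cong ι1≈1 refl) (*-identityˡ _)))
  mono*ι⁻¹[den]≈weight y i (r ∷ rs) = begin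
    (pow (y i′) r * mono y (suc i′) rs) * (ι ((r ! ℕ.* ((i′ !) ℕ.^ r)) ℕ.* den (suc i′) rs)) ⁻¹
      ≈⟨ *-cong refl (⁻¹-cong (ι[den]≉0 i′ (r ∷ rs)) ι[den]≈) ⟩
    (pow (y i′) r * mono y (suc i′) rs) * ((ι (r !) * pow (ι (i′ !)) r) * ι (den (suc i′) rs)) ⁻¹
      ≈⟨ *-cong refl (trans (⁻¹-* (*-nonZero (ι[n!]≉0 r) (pow-nonZero r (ι[n!]≉0 i′))) (ι[den]≉0 (suc i′) rs))
                            (*-cong (trans (⁻¹-* (ι[n!]≉0 r) (pow-nonZero r (ι[n!]≉0 i′))) (*-cong refl (pow-⁻¹ r (ι[n!]≉0 i′)))) refl)) ⟩
    (pow (y i′) r * mono y (suc i′) rs) * ((ι⁻¹ (r !) * pow (ι⁻¹ (i′ !)) r) * (ι (den (suc i′) rs)) ⁻¹)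
      ≈⟨ zsolve 5 (λ p m a q d → ((p :* m) :* ((a :* q) :* d)) := (((p :* q) :* a) :* (m :* d)))
           refl (pow (y i′) r) (mono y (suc i′) rs) (ι⁻¹ (r !)) (pow (ι⁻¹ (i′ !)) r) ((ι (den (suc i′) rs)) ⁻¹) ⟩
    ((pow (y i′) r * pow (ι⁻¹ (i′ !)) r) * ι⁻¹ (r !)) * (mono y (suc i′) rs * (ι (den (suc i′) rs)) ⁻¹)
      ≈⟨ *-cong (*-cong (sym (pow-* (y i′) (ι⁻¹ (i′ !)) r)) refl) (mono*ι⁻¹[den]≈weight y (suc i) rs) ⟩
    (pow (egf y i′) r * ι⁻¹ (r !)) * weight (egf y) (suc i′) rs ∎
    where
    i′ = suc i
    ι[den]≈ : ι ((r ! ℕ.* ((i′ !) ℕ.^ r)) ℕ.* den (suc i′) rs) ≈ (ι (r !) * pow (ι (i′ !)) r) * ι (den (suc i′) rs)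
    ι[den]≈ = trans (ι-* (r ! ℕ.* ((i′ !) ℕ.^ r)) (den (suc i′) rs)) (*-cong (trans (ι-* (r !) ((i′ !) ℕ.^ r)) (*-cong refl (ι-^ (i′ !) r))) refl)

  ι-/ : ∀ m d .{{_ : ℕ.NonZero d}} → d ∣ m → ι (m / d) ≈ ι m * (ι d) ⁻¹
  ι-/ m d d∣m = trans (*≈⇒≈⁻¹* (ι-nonZero d) (trans (*-comm _ _) (trans (sym (ι-* (m / d) d)) (reflexive (P.cong ι (m/n*n≡m d∣m)))))) (*-comm _ _)

  private
    bellTerm : ∀ n k y {l} (rs : Vec ℕ l) →
      𝟙 ((vsum rs ℕ.≟ k) ×-dec (wsum 1 rs ℕ.≟ n)) * (ι (bellCoeff n rs) * mono y 1 rs) ≈ ι (n !) * bellSummand (egf y) 1 n k rs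
    bellTerm n k y rs with vsum rs ℕ.≟ k | wsum 1 rs ℕ.≟ n
    ... | yes _ | no _  = trans (zeroˡ _) (sym (trans (*-cong refl (trans (*-cong refl (zeroˡ _)) (zeroʳ _))) (zeroʳ _)))
    ... | no _  | no _  = trans (zeroˡ _) (sym (trans (*-cong refl (zeroˡ _)) (zeroʳ _)))
    ... | no _  | yes _ = trans (zeroˡ _) (sym (trans (*-cong refl (zeroˡ _)) (zeroʳ _)))
    ... | yes _ | yes wsum≡n = begin
      1# * (ι (bellCoeff n rs) * mono y 1 rs)          ≈⟨ *-identityˡ _ ⟩
      ι ((n ! / den 1 rs) {{den-nz 1 rs}}) * mono y 1 rs
        ≈⟨ *-cong (ι-/ (n !) (den 1 rs) {{den-nz 1 rs}} (P.subst (λ t → den 1 rs ∣ t !) wsum≡n (den∣wsum! 0 rs))) refl ⟩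
      (ι (n !) * (ι (den 1 rs)) ⁻¹) * mono y 1 rs     ≈⟨ zsolve 3 (λ a b m → ((a :* b) :* m) := (a :* (m :* b))) refl (ι (n !)) ((ι (den 1 rs)) ⁻¹) (mono y 1 rs) ⟩
      ι (n !) * (mono y 1 rs * (ι (den 1 rs)) ⁻¹)     ≈⟨ *-cong refl (mono*ι⁻¹[den]≈weight y 0 rs) ⟩
      ι (n !) * weight (egf y) 1 rs                   ≈⟨ *-cong refl (sym (trans (*-identityˡ _) (*-identityˡ _))) ⟩
      ι (n !) * (1# * (1# * weight (egf y) 1 rs))     ∎

    bellSum≈Bell : ∀ n k y → suc k ≤ n →
      sumL (map (λ rs → ι (bellCoeff n rs) * mono y 1 rs) (bellIndex n (suc k))) ≈ ι (n !) * dpow (egf y) (suc k) n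
    bellSum≈Bell n k y 1+k≤n = begin
      ∑ᴸ (filter P? V) g                                        ≈⟨ ∑ᴸ-filter P? V g ⟩
      ∑ᴸ V (λ rs → 𝟙 (P? rs) * g rs)                            ≈⟨ ∑ᴸ-cong V (bellTerm n (suc k) y) ⟩
      ∑ᴸ V (λ rs → ι (n !) * bellSummand (egf y) 1 n (suc k) rs) ≈⟨ sym (∑ᴸ-*ˡ V (ι (n !)) _) ⟩
      ι (n !) * bellSum (egf y) 1 n n n (suc k)                 ≈⟨ *-cong refl (bellSum≈dpow (egf y) n 1 n n (suc k) 1+k≤n) ⟩
      ι (n !) * dpow (window (egf y) 1 n) (suc k) n            ≈⟨ *-cong refl (dpow-cong≤ n (suc k) (window≈egf y n) n ℕ.≤-refl) ⟩
      ι (n !) * dpow (egf y) (suc k) n                         ∎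
      where
      V = vecsUpTo n n
      P? = λ (rs : Vec ℕ n) → (vsum rs ℕ.≟ suc k) ×-dec (wsum 1 rs ℕ.≟ n)
      g = λ (rs : Vec ℕ n) → ι (bellCoeff n rs) * mono y 1 rs

    Bell-suc≈dpow : ∀ n k y →
      (if suc k ℕ.≤ᵇ n then sumL (map (λ rs → ι (bellCoeff n rs) * mono y 1 rs) (bellIndex n (suc k))) else 0#)
      ≈ ι (n !) * dpow (egf y) (suc k) n
    Bell-suc≈dpow n k y with suc k ℕ.≤ᵇ n in eq
    ... | true  = bellSum≈Bell n k y (ℕ.≤ᵇ⇒≤ (suc k) n (P.subst T (P.sym eq) _))
    ... | false = sym (trans (*-cong refl (dpow-vanish (egf y) refl (suc k) n (ℕ.≰⇒> (λ 1+k≤n → P.subst T eq (ℕ.≤⇒≤ᵇ 1+k≤n))))) (zeroʳ _))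

  Bell≈dpow : ∀ n k y → Bell n k y ≈ ι (n !) * dpow (egf y) k n
  Bell≈dpow zero    zero    y = sym (trans (*-cong ι1≈1 (dpow-zero (egf y) 0)) (*-identityˡ _))
  Bell≈dpow (suc n) zero    y = sym (trans (*-cong refl (dpow-zero (egf y) (suc n))) (zeroʳ _))
  Bell≈dpow zero    (suc k) y = Bell-suc≈dpow zero k y
  Bell≈dpow (suc n) (suc k) y = Bell-suc≈dpow (suc n) k y


-- pot r is the power series g^r of g = x₀ + f, written through its binomial expansion
-- Σ_j r(r-1)⋯(r-j+1) x₀^{r-j} f^j / j!; its coefficients are the potential polynomials.
module PotentialSeries {c ℓ : Level} (F : Char0Field c ℓ) (x : ℕ → Char0Field.Carrier F) where

  open import Data.Nat as ℕ using (ℕ; zero; suc; _∸_; _≤_; _<_; z≤n; s≤s; _!)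
  import Data.Nat.Properties as ℕ
  open import Data.Integer as ℤ using (ℤ; +_; -[1+_])
  import Data.Integer.Properties as ℤ
  open import Data.Integer.Tactic.RingSolver using (solve-∀)
  open import Data.Empty using (⊥-elim)
  open import Relation.Nullary using (yes; no)
  open import Relation.Binary.PropositionalEquality as P using (_≡_)
  open FallingFactorial
  open BellPolynomials F public
  open import Algebra.Properties.CommutativeSemigroup *-commutativeSemigroup using (x∙yz≈y∙xz)

  x₀ : Carrier
  x₀ = x 0

  f : Series
  f = egf x

  g : Series
  g zero    = x₀
  g (suc n) = f (suc n)

  potCoeff : ℤ → ℕ → Carrier
  potCoeff r j = ιℤ (falling r j) * zpow x₀ (r ℤ.- + j)

  pot : ℤ → Series
  pot r m = ∑ (suc m) (λ j → potCoeff r j * dpow f j m)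

  pot-≡ : ∀ {r r′} → r ≡ r′ → pot r ≋ pot r′
  pot-≡ P.refl m = refl

  conv-pot : ∀ b r m → conv b (pot r) m ≈ ∑ (suc m) (λ j → potCoeff r j * conv b (dpow f j) m)
  conv-pot b r m = begin
    conv b (pot r) m
      ≈⟨ conv-cong≤ {b} {b} {pot r} {∑ˢ (suc m) (λ j → potCoeff r j • dpow f j)} m (λ _ _ → refl) (λ n n≤m → pot-extend n (s≤s n≤m)) ⟩
    conv b (∑ˢ (suc m) (λ j → potCoeff r j • dpow f j)) m
      ≈⟨ conv-∑ˢ b (suc m) (λ j → potCoeff r j • dpow f j) m ⟩
    ∑ (suc m) (λ j → conv b (potCoeff r j • dpow f j) m)
      ≈⟨ ∑-cong (suc m) (λ j → conv-•ʳ (potCoeff r j) b (dpow f j) m) ⟩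
    ∑ (suc m) (λ j → potCoeff r j * conv b (dpow f j) m) ∎
    where
    pot-extend : ∀ n → n < suc m → pot r n ≈ ∑ (suc m) (λ j → potCoeff r j * dpow f j n)
    pot-extend n n≤m = sym (∑-extend _ n≤m (λ j n<j _ → trans (*-cong refl (dpow-vanish f refl j n n<j)) (zeroʳ _)))

  pot-0 : pot (+ 0) ≋ 1ˢ
  pot-0 m = begin
    pot (+ 0) m                ≈⟨ ∑-single (suc m) 0 _ (s≤s z≤n) (λ { zero _ 0≢0 → ⊥-elim (0≢0 P.refl) ; (suc j) _ _ → higher≈0 j }) ⟩
    (ι 1 * 1#) * dpow f 0 m    ≈⟨ trans (*-cong (trans (*-identityʳ _) ι1≈1) refl) (*-identityˡ _) ⟩
    dpow f 0 m                 ≈⟨ dpow-zero f m ⟩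
    1ˢ m                       ∎
    where
    higher≈0 : ∀ j → potCoeff (+ 0) (suc j) * dpow f (suc j) m ≈ 0#
    higher≈0 j = trans (*-cong (trans (*-cong (reflexive (P.cong ιℤ (falling-vanishes 0 (suc j) (s≤s z≤n)))) refl) (zeroˡ _)) refl) (zeroˡ _)

  -- x₀ · x₀^{r-j} = x₀^{r+1-j} wherever the falling factorial does not vanish: for every r when
  -- x₀ is invertible, and for r ∈ ℕ (where only j ≤ r matters) even when x₀ = 0.
  X₀Step : ℤ → Set ℓ
  X₀Step r = ∀ j → ιℤ (falling r j) * (x₀ * zpow x₀ (r ℤ.- + j)) ≈ ιℤ (falling r j) * zpow x₀ (ℤ.suc r ℤ.- + j)

  private
    [1+r]-j : ∀ r j → (+ 1 ℤ.+ r) ℤ.- j ≡ + 1 ℤ.+ (r ℤ.- j)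
    [1+r]-j = solve-∀

    [1+r]-[1+j] : ∀ r j → ℤ.suc r ℤ.- + suc j ≡ r ℤ.- + j
    [1+r]-[1+j] r j = P.trans (P.cong (λ t → ℤ.suc r ℤ.- t) (ℤ.pos-+ 1 j)) (lemma r (+ j))
      where
      lemma : ∀ r j → (+ 1 ℤ.+ r) ℤ.- (+ 1 ℤ.+ j) ≡ r ℤ.- j
      lemma = solve-∀

    +n-+j : ∀ {n j} → j ≤ n → + n ℤ.- + j ≡ + (n ∸ j)
    +n-+j {n} {j} j≤n = P.trans (ℤ.m-n≡m⊖n n j) (ℤ.⊖-≥ j≤n)

  X₀Step-ℕ : ∀ n → X₀Step (+ n)
  X₀Step-ℕ n j with j ℕ.≤? n
  ... | yes j≤n = *-cong refl (begin
    x₀ * zpow x₀ (+ n ℤ.- + j)         ≈⟨ *-cong refl (reflexive (P.cong (zpow x₀) (+n-+j j≤n))) ⟩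
    pow x₀ (suc (n ∸ j))               ≈⟨ reflexive (P.cong (zpow x₀) (P.sym (P.trans (+n-+j (ℕ.m≤n⇒m≤1+n j≤n)) (P.cong +_ (ℕ.+-∸-assoc 1 j≤n))))) ⟩
    zpow x₀ (+ suc n ℤ.- + j)          ∎)
  ... | no j≰n  = trans (*-cong falling≈0 refl) (trans (zeroˡ _) (sym (trans (*-cong falling≈0 refl) (zeroˡ _))))
    where
    falling≈0 : ιℤ (falling (+ n) j) ≈ 0#
    falling≈0 = reflexive (P.cong ιℤ (falling-vanishes n j (ℕ.≰⇒> j≰n)))

  X₀Step-invertible : ¬ (x₀ ≈ 0#) → ∀ r → X₀Step r
  X₀Step-invertible x₀≉0 r j = *-cong refl (sym (begin
    zpow x₀ (ℤ.suc r ℤ.- + j)             ≈⟨ reflexive (P.cong (zpow x₀) ([1+r]-j r (+ j))) ⟩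
    zpow x₀ (+ 1 ℤ.+ (r ℤ.- + j))         ≈⟨ zpow-+ x₀≉0 (+ 1) (r ℤ.- + j) ⟩
    (x₀ * 1#) * zpow x₀ (r ℤ.- + j)       ≈⟨ *-cong (*-identityʳ x₀) refl ⟩
    x₀ * zpow x₀ (r ℤ.- + j)              ∎))

  potCoeff-suc-0 : ∀ r → X₀Step r → potCoeff (ℤ.suc r) 0 ≈ x₀ * potCoeff r 0
  potCoeff-suc-0 r step = sym (trans (zsolve 3 (λ a p z → (a :* (p :* z)) := (p :* (a :* z))) refl x₀ (ιℤ (falling r 0)) (zpow x₀ (r ℤ.- + 0))) (step 0))

  potCoeff-suc-suc : ∀ r → X₀Step r → ∀ j → potCoeff (ℤ.suc r) (suc j) ≈ x₀ * potCoeff r (suc j) + ι (suc j) * potCoeff r j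
  potCoeff-suc-suc r step j = begin
    ιℤ (falling (ℤ.suc r) (suc j)) * zpow x₀ (ℤ.suc r ℤ.- + suc j)
      ≈⟨ *-cong pascal (reflexive (P.cong (zpow x₀) ([1+r]-[1+j] r j))) ⟩
    (ιℤ (falling r (suc j)) + ι (suc j) * ιℤ (falling r j)) * zpow x₀ (r ℤ.- + j)
      ≈⟨ distribʳ _ _ _ ⟩
    ιℤ (falling r (suc j)) * zpow x₀ (r ℤ.- + j) + (ι (suc j) * ιℤ (falling r j)) * zpow x₀ (r ℤ.- + j)
      ≈⟨ +-cong (trans (*-cong refl (reflexive (P.cong (zpow x₀) (P.sym ([1+r]-[1+j] r j))))) (sym (step (suc j)))) (*-assoc _ _ _) ⟩
    ιℤ (falling r (suc j)) * (x₀ * zpow x₀ (r ℤ.- + suc j)) + ι (suc j) * potCoeff r j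
      ≈⟨ +-cong (zsolve 3 (λ p a z → (p :* (a :* z)) := (a :* (p :* z))) refl (ιℤ (falling r (suc j))) x₀ (zpow x₀ (r ℤ.- + suc j))) refl ⟩
    x₀ * potCoeff r (suc j) + ι (suc j) * potCoeff r j ∎
    where
    pascal : ιℤ (falling (ℤ.suc r) (suc j)) ≈ ιℤ (falling r (suc j)) + ι (suc j) * ιℤ (falling r j)
    pascal = trans (reflexive (P.cong ιℤ (falling-pascal r j))) (trans (ιℤ-+ (falling r (suc j)) (+ suc j ℤ.* falling r j)) (+-cong refl (ιℤ-* (+ suc j) (falling r j))))

  potCoeff-suc-suc′ : ∀ r j → potCoeff (ℤ.suc r) (suc j) ≈ ιℤ (ℤ.suc r) * potCoeff r j
  potCoeff-suc-suc′ r j = begin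
    ιℤ (falling (ℤ.suc r) (suc j)) * zpow x₀ (ℤ.suc r ℤ.- + suc j)
      ≈⟨ *-cong (trans (reflexive (P.cong ιℤ (falling-suc-suc r j))) (ιℤ-* (ℤ.suc r) (falling r j))) (reflexive (P.cong (zpow x₀) ([1+r]-[1+j] r j))) ⟩
    (ιℤ (ℤ.suc r) * ιℤ (falling r j)) * zpow x₀ (r ℤ.- + j)
      ≈⟨ *-assoc _ _ _ ⟩
    ιℤ (ℤ.suc r) * potCoeff r j ∎

  conv-g-dpow : ∀ j m → conv g (dpow f j) m ≈ x₀ * dpow f j m + ι (suc j) * dpow f (suc j) m
  conv-g-dpow j m = begin
    conv g (dpow f j) m                          ≈⟨ ∑-suc m _ ⟩
    x₀ * dpow f j m + ∑ m (λ i → f (suc i) * dpow f j (m ∸ suc i))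
      ≈⟨ +-cong refl (sym (trans (∑-suc m _) (trans (+-cong (zeroˡ _) refl) (+-identityˡ _)))) ⟩
    x₀ * dpow f j m + conv f (dpow f j) m        ≈⟨ +-cong refl (sym (dpow-suc f j m)) ⟩
    x₀ * dpow f j m + ι (suc j) * dpow f (suc j) m ∎

  conv-g-pot : ∀ r → X₀Step r → conv g (pot r) ≋ pot (ℤ.suc r)
  conv-g-pot r step m = begin
    conv g (pot r) m
      ≈⟨ conv-pot g r m ⟩
    ∑ (suc m) (λ j → potCoeff r j * conv g (dpow f j) m)
      ≈⟨ ∑-cong (suc m) (λ j → *-cong refl (conv-g-dpow j m)) ⟩
    ∑ (suc m) (λ j → potCoeff r j * (x₀ * dpow f j m + ι (suc j) * dpow f (suc j) m))
      ≈⟨ ∑-recurrence m x₀ (potCoeff r) (potCoeff (ℤ.suc r)) (λ j → dpow f j m)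
           (potCoeff-suc-0 r step) (potCoeff-suc-suc r step) (dpow-vanish f refl (suc m) m (ℕ.n<1+n m)) ⟩
    pot (ℤ.suc r) m ∎

  conv-pot-+ℕ : ∀ n b → (∀ i → X₀Step (+ i ℤ.+ b)) → conv (pot (+ n)) (pot b) ≋ pot (+ n ℤ.+ b)
  conv-pot-+ℕ zero    b _    m = trans (conv-cong {pot (+ 0)} {1ˢ} {pot b} {pot b} pot-0 (λ _ → refl) m) (trans (conv-identityˡ (pot b) m) (pot-≡ (P.sym (ℤ.+-identityˡ b)) m))
  conv-pot-+ℕ (suc n) b step m = begin
    conv (pot (+ suc n)) (pot b) m
      ≈⟨ conv-cong {pot (+ suc n)} {conv g (pot (+ n))} {pot b} {pot b} (λ k → sym (conv-g-pot (+ n) (X₀Step-ℕ n) k)) (λ _ → refl) m ⟩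
    conv (conv g (pot (+ n))) (pot b) m
      ≈⟨ conv-assoc g (pot (+ n)) (pot b) m ⟩
    conv g (conv (pot (+ n)) (pot b)) m
      ≈⟨ conv-cong {g} {g} {conv (pot (+ n)) (pot b)} {pot (+ n ℤ.+ b)} (λ _ → refl) (conv-pot-+ℕ n b step) m ⟩
    conv g (pot (+ n ℤ.+ b)) m
      ≈⟨ conv-g-pot (+ n ℤ.+ b) (step n) m ⟩
    pot (ℤ.suc (+ n ℤ.+ b)) m
      ≈⟨ pot-≡ (P.sym (ℤ.+-assoc (+ 1) (+ n) b)) m ⟩
    pot (+ suc n ℤ.+ b) m ∎

  pot-+ℕ : ∀ a b → conv (pot (+ a)) (pot (+ b)) ≋ pot (+ (a ℕ.+ b))
  pot-+ℕ a b = conv-pot-+ℕ a (+ b) (λ i → X₀Step-ℕ (i ℕ.+ b))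

  pot-1 : pot (+ 1) ≋ g
  pot-1 n = trans (sym (conv-g-pot (+ 0) (X₀Step-ℕ 0) n)) (trans (conv-cong {g} {g} {pot (+ 0)} {1ˢ} (λ _ → refl) pot-0 n) (conv-identityʳ g n))

  powˢ-g : ∀ k → powˢ g k ≋ pot (+ k)
  powˢ-g zero    n = sym (pot-0 n)
  powˢ-g (suc k) n = trans (conv-cong {g} {g} {powˢ g k} {pot (+ k)} (λ _ → refl) (powˢ-g k) n) (conv-g-pot (+ k) (X₀Step-ℕ k) n)

  pot-+ : ¬ (x₀ ≈ 0#) → ∀ a b → conv (pot a) (pot b) ≋ pot (a ℤ.+ b)
  pot-+ x₀≉0 (+ n)    b = conv-pot-+ℕ n b (λ i → X₀Step-invertible x₀≉0 _)
  pot-+ x₀≉0 -[1+ n ] b = pot-+-negative n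
    where
    pot-+-negative : ∀ n → conv (pot -[1+ n ]) (pot b) ≋ pot (-[1+ n ] ℤ.+ b)
    pot-+-negative n = conv-cancelˡ g x₀≉0 (λ m → begin
      conv g (conv (pot r) (pot b)) m      ≈⟨ sym (conv-assoc g (pot r) (pot b) m) ⟩
      conv (conv g (pot r)) (pot b) m      ≈⟨ conv-cong {conv g (pot r)} {pot (ℤ.suc r)} {pot b} {pot b} (conv-g-pot r (X₀Step-invertible x₀≉0 r)) (λ _ → refl) m ⟩
      conv (pot (ℤ.suc r)) (pot b) m       ≈⟨ pot-+-previous n m ⟩
      pot (ℤ.suc r ℤ.+ b) m                ≈⟨ pot-≡ (ℤ.+-assoc (+ 1) r b) m ⟩
      pot (ℤ.suc (r ℤ.+ b)) m              ≈⟨ sym (conv-g-pot (r ℤ.+ b) (X₀Step-invertible x₀≉0 _) m) ⟩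
      conv g (pot (r ℤ.+ b)) m             ∎)
      where
      r = -[1+ n ]
      pot-+-previous : ∀ n → conv (pot (ℤ.suc -[1+ n ])) (pot b) ≋ pot (ℤ.suc -[1+ n ] ℤ.+ b)
      pot-+-previous zero    = pot-+ x₀≉0 (+ 0) b
      pot-+-previous (suc n) = pot-+-negative n

  θ-pot : ∀ r → θ (pot (ℤ.suc r)) ≋ (ιℤ (ℤ.suc r) • conv (θ f) (pot r))
  θ-pot r m = begin
    ι m * ∑ (suc m) (λ j → potCoeff (ℤ.suc r) j * dpow f j m)
      ≈⟨ trans (∑-*ˡ (suc m) (ι m) _) (∑-cong (suc m) (λ j → zsolve 3 (λ i c d → (i :* (c :* d)) := (c :* (i :* d))) refl (ι m) (potCoeff (ℤ.suc r) j) (dpow f j m))) ⟩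
    ∑ (suc m) (λ j → potCoeff (ℤ.suc r) j * θ (dpow f j) m)
      ≈⟨ ∑-suc m _ ⟩
    potCoeff (ℤ.suc r) 0 * θ (dpow f 0) m + ∑ m (λ j → potCoeff (ℤ.suc r) (suc j) * θ (dpow f (suc j)) m)
      ≈⟨ +-cong (trans (*-cong refl (θ-dpow-zero f m)) (zeroʳ _)) (∑-cong m (λ j → *-cong (potCoeff-suc-suc′ r j) (θ-dpow-suc f j m))) ⟩
    0# + ∑ m (λ j → (ιℤ (ℤ.suc r) * potCoeff r j) * conv (θ f) (dpow f j) m)
      ≈⟨ trans (+-identityˡ _) (trans (∑-cong m (λ j → *-assoc _ _ _)) (sym (∑-*ˡ m (ιℤ (ℤ.suc r)) _))) ⟩
    ιℤ (ℤ.suc r) * ∑ m (λ j → potCoeff r j * conv (θ f) (dpow f j) m)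
      ≈⟨ *-cong refl (sym conv-θf-pot) ⟩
    ιℤ (ℤ.suc r) * conv (θ f) (pot r) m ∎
    where
    conv-θf-pot : conv (θ f) (pot r) m ≈ ∑ m (λ j → potCoeff r j * conv (θ f) (dpow f j) m)
    conv-θf-pot = begin
      conv (θ f) (pot r) m                                                                       ≈⟨ conv-pot (θ f) r m ⟩
      ∑ (suc m) (λ j → potCoeff r j * conv (θ f) (dpow f j) m)                                   ≈⟨ ∑-last m _ ⟩
      ∑ m (λ j → potCoeff r j * conv (θ f) (dpow f j) m) + potCoeff r m * conv (θ f) (dpow f m) m ≈⟨ +-cong refl (trans (*-cong refl last≈0) (zeroʳ _)) ⟩
      ∑ m (λ j → potCoeff r j * conv (θ f) (dpow f j) m) + 0#                                    ≈⟨ +-identityʳ _ ⟩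
      ∑ m (λ j → potCoeff r j * conv (θ f) (dpow f j) m)                                         ∎
      where
      last≈0 : conv (θ f) (dpow f m) m ≈ 0#
      last≈0 = trans (sym (θ-dpow-suc f m m)) (trans (*-cong refl (dpow-vanish f refl (suc m) m (ℕ.n<1+n m))) (zeroʳ _))

  -- Abel's identity: θ(g^{r+1}) · g^s = (r+1)/(r+1+s) · θ(g^{r+1+s}), with the denominator cleared.
  abel : ∀ r s → conv (pot r) (pot s) ≋ pot (r ℤ.+ s) → ∀ m →
    ιℤ (ℤ.suc r ℤ.+ s) * conv (θ (pot (ℤ.suc r))) (pot s) m ≈ ιℤ (ℤ.suc r) * (ι m * pot (ℤ.suc r ℤ.+ s) m)
  abel r s pot-r+s m = begin
    ιℤ (ℤ.suc r ℤ.+ s) * conv (θ (pot (ℤ.suc r))) (pot s) m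
      ≈⟨ *-cong refl conv-θ-pot ⟩
    ιℤ (ℤ.suc r ℤ.+ s) * (ιℤ (ℤ.suc r) * K)
      ≈⟨ zsolve 3 (λ a b k → (a :* (b :* k)) := (b :* (a :* k))) refl (ιℤ (ℤ.suc r ℤ.+ s)) (ιℤ (ℤ.suc r)) K ⟩
    ιℤ (ℤ.suc r) * (ιℤ (ℤ.suc r ℤ.+ s) * K)
      ≈⟨ *-cong refl (trans (*-cong (reflexive (P.cong ιℤ 1+r+s≡)) refl) (sym (trans (*-cong refl (pot-≡ 1+r+s≡ m)) (θ-pot (r ℤ.+ s) m)))) ⟩
    ιℤ (ℤ.suc r) * (ι m * pot (ℤ.suc r ℤ.+ s) m) ∎
    where
    1+r+s≡ : ℤ.suc r ℤ.+ s ≡ ℤ.suc (r ℤ.+ s)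
    1+r+s≡ = ℤ.+-assoc (+ 1) r s
    K = conv (θ f) (pot (r ℤ.+ s)) m
    conv-θ-pot : conv (θ (pot (ℤ.suc r))) (pot s) m ≈ ιℤ (ℤ.suc r) * K
    conv-θ-pot = begin
      conv (θ (pot (ℤ.suc r))) (pot s) m
        ≈⟨ conv-cong {θ (pot (ℤ.suc r))} {ιℤ (ℤ.suc r) • conv (θ f) (pot r)} {pot s} {pot s} (θ-pot r) (λ _ → refl) m ⟩
      conv (ιℤ (ℤ.suc r) • conv (θ f) (pot r)) (pot s) m
        ≈⟨ conv-•ˡ (ιℤ (ℤ.suc r)) (conv (θ f) (pot r)) (pot s) m ⟩
      ιℤ (ℤ.suc r) * conv (conv (θ f) (pot r)) (pot s) m
        ≈⟨ *-cong refl (conv-assoc (θ f) (pot r) (pot s) m) ⟩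
      ιℤ (ℤ.suc r) * conv (θ f) (conv (pot r) (pot s)) m
        ≈⟨ *-cong refl (conv-cong {θ f} {θ f} {conv (pot r) (pot s)} {pot (r ℤ.+ s)} (λ _ → refl) pot-r+s m) ⟩
      ιℤ (ℤ.suc r) * K ∎

  Phat≈pot : ∀ m r → Phat m r x ≈ ι (m !) * pot r m
  Phat≈pot m r = begin
    Phat m r x
      ≈⟨ sumFromTo≈∑ 0 m _ ⟩
    ∑ (suc m) (λ j → potCoeff r j * Bell m j x)
      ≈⟨ ∑-cong (suc m) (λ j → trans (*-cong refl (Bell≈dpow m j x)) (x∙yz≈y∙xz (potCoeff r j) (ι (m !)) (dpow f j m))) ⟩
    ∑ (suc m) (λ j → ι (m !) * (potCoeff r j * dpow f j m))
      ≈⟨ sym (∑-*ˡ (suc m) (ι (m !)) _) ⟩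
    ι (m !) * pot r m ∎

  That≈Phat : ∀ m → That (suc m) x ≈ Phat m (+ suc m) x
  That≈Phat m = begin
    That (suc m) x
      ≈⟨ sumFromTo≈∑ 0 m _ ⟩
    ∑ (suc m) (λ k → ιℤ (falling (+ suc m) k) * pow x₀ (suc m ∸ k) * Bell m k x)
      ≈⟨ ∑-cong< (suc m) (λ k k≤m → *-cong (*-cong refl (reflexive (P.cong (zpow x₀) (P.sym (+n-+j (ℕ.≤-pred (ℕ.m≤n⇒m≤1+n k≤m))))))) refl) ⟩
    ∑ (suc m) (λ k → potCoeff (+ suc m) k * Bell m k x)
      ≈⟨ sym (sumFromTo≈∑ 0 m _) ⟩
    Phat m (+ suc m) x ∎


-- τ = Σ_{j ≥ 1} T̂_j t^j / j! is the solution of τ = t · g(τ).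
module TreeFunction {c ℓ : Level} (F : Char0Field c ℓ) (x : ℕ → Char0Field.Carrier F) where

  open import Data.Nat as ℕ using (ℕ; zero; suc; _∸_; _≤_; _<_; z≤n; s≤s; _!)
  import Data.Nat.Properties as ℕ
  open import Data.Nat.Induction using (<-rec)
  open import Data.Integer as ℤ using (+_)
  open import Relation.Nullary using (yes; no)
  import Relation.Binary.PropositionalEquality as P
  open PotentialSeries F x public

  τ : Series
  τ = egf (Tsub x)

  τ-suc : ∀ m → τ (suc m) ≈ ι⁻¹ (suc m) * pot (+ suc m) m
  τ-suc m = begin
    That (suc m) x * ι⁻¹ (suc m !)
      ≈⟨ *-cong (trans (That≈Phat m) (Phat≈pot m (+ suc m))) (ι⁻¹[suc-n!] m) ⟩
    (ι (m !) * pot (+ suc m) m) * (ι⁻¹ (suc m) * ι⁻¹ (m !))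
      ≈⟨ zsolve 4 (λ a p b d → ((a :* p) :* (b :* d)) := ((a :* d) :* (b :* p))) refl (ι (m !)) (pot (+ suc m) m) (ι⁻¹ (suc m)) (ι⁻¹ (m !)) ⟩
    (ι (m !) * ι⁻¹ (m !)) * (ι⁻¹ (suc m) * pot (+ suc m) m)
      ≈⟨ trans (*-cong (ι[n!]*ι⁻¹[n!] m) refl) (*-identityˡ _) ⟩
    ι⁻¹ (suc m) * pot (+ suc m) m ∎

  -- The value of [tⁿ] τ^k predicted by Lagrange inversion: (k/n) [t^{n-k}] gⁿ.
  lagrange : ℕ → ℕ → Carrier
  lagrange zero    zero    = 1#
  lagrange zero    (suc k) = 0#
  lagrange (suc n) k       = 𝟙 (k ℕ.≤? suc n) * (ι⁻¹ (suc n) * (ι k * pot (+ suc n) (suc n ∸ k)))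

  lagrange-k≤n : ∀ n k → k ≤ suc n → lagrange (suc n) k ≈ ι⁻¹ (suc n) * (ι k * pot (+ suc n) (suc n ∸ k))
  lagrange-k≤n n k k≤1+n = trans (*-cong (𝟙-yes (k ℕ.≤? suc n) k≤1+n) refl) (*-identityˡ _)

  lagrange-diagonal : ∀ k → lagrange (suc k) (suc k) ≈ pot (+ suc k) 0
  lagrange-diagonal k = begin
    lagrange (suc k) (suc k)                               ≈⟨ lagrange-k≤n k (suc k) ℕ.≤-refl ⟩
    ι⁻¹ (suc k) * (ι (suc k) * pot (+ suc k) (k ∸ k))      ≈⟨ sym (*-assoc _ _ _) ⟩
    (ι⁻¹ (suc k) * ι (suc k)) * pot (+ suc k) (k ∸ k)      ≈⟨ trans (*-cong (trans (*-comm _ _) (ι*ι⁻¹ (suc k))) refl) (*-identityˡ _) ⟩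
    pot (+ suc k) (k ∸ k)                                  ≈⟨ reflexive (P.cong (pot (+ suc k)) (ℕ.n∸n≡0 k)) ⟩
    pot (+ suc k) 0                                        ∎

  -- Multiplying Abel's identity for g^{k+1} · g^{m} by 1/(k+1+m) = 1/n.
  lagrange-recursion : ∀ k m → lagrange (suc k ℕ.+ m) (suc k) ≈ ∑ (suc m) (λ j → pot (+ suc k) j * lagrange m j)
  lagrange-recursion k zero = begin
    lagrange (suc (k ℕ.+ 0)) (suc k)        ≈⟨ reflexive (P.cong (λ t → lagrange (suc t) (suc k)) (ℕ.+-identityʳ k)) ⟩
    lagrange (suc k) (suc k)                ≈⟨ lagrange-diagonal k ⟩
    pot (+ suc k) 0                         ≈⟨ sym (trans (∑-one _) (*-identityʳ _)) ⟩
    ∑ 1 (λ j → pot (+ suc k) j * lagrange 0 j) ∎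
  lagrange-recursion k (suc m′) = begin
    lagrange n (suc k)
      ≈⟨ lagrange-k≤n (k ℕ.+ m) (suc k) (s≤s (ℕ.m≤m+n k m)) ⟩
    ι⁻¹ n * (ι (suc k) * pot (+ n) (n ∸ suc k))
      ≈⟨ *-cong refl (*-cong refl (reflexive (P.cong (pot (+ n)) (ℕ.m+n∸m≡n k m)))) ⟩
    ι⁻¹ n * (ι (suc k) * pot (+ n) m)
      ≈⟨ divided-abel ⟩
    ι⁻¹ m * C
      ≈⟨ ∑-*ˡ (suc m) (ι⁻¹ m) _ ⟩
    ∑ (suc m) (λ j → ι⁻¹ m * (θ (pot (+ suc k)) j * pot (+ m) (m ∸ j)))
      ≈⟨ ∑-cong< (suc m) (λ j j≤m → trans (rearrange (ι⁻¹ m) (ι j) (pot (+ suc k) j) (pot (+ m) (m ∸ j))) (*-cong refl (sym (lagrange-k≤n m′ j (ℕ.≤-pred j≤m))))) ⟩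
    ∑ (suc m) (λ j → pot (+ suc k) j * lagrange m j) ∎
    where
    m = suc m′
    n = suc k ℕ.+ m
    C = conv (θ (pot (+ suc k))) (pot (+ m)) m
    rearrange : ∀ a b p q → a * ((b * p) * q) ≈ p * (a * (b * q))
    rearrange = zsolve 4 (λ a b p q → (a :* ((b :* p) :* q)) := (p :* (a :* (b :* q)))) refl
    divided-abel : ι⁻¹ n * (ι (suc k) * pot (+ n) m) ≈ ι⁻¹ m * C
    divided-abel = begin
      ι⁻¹ n * (ι (suc k) * pot (+ n) m)
        ≈⟨ sym (trans (*-cong (trans (*-comm _ _) (ι*ι⁻¹ m)) refl) (*-identityˡ _)) ⟩
      (ι⁻¹ m * ι m) * (ι⁻¹ n * (ι (suc k) * pot (+ n) m))
        ≈⟨ zsolve 5 (λ a b c d e → ((a :* b) :* (c :* (d :* e))) := (a :* (c :* (d :* (b :* e))))) refl (ι⁻¹ m) (ι m) (ι⁻¹ n) (ι (suc k)) (pot (+ n) m) ⟩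
      ι⁻¹ m * (ι⁻¹ n * (ι (suc k) * (ι m * pot (+ n) m)))
        ≈⟨ *-cong refl (sym (*≈⇒≈⁻¹* (char0 (k ℕ.+ m)) (abel (+ k) (+ m) (pot-+ℕ k m) m))) ⟩
      ι⁻¹ m * C ∎

  lagrange-recursion′ : ∀ k n → suc k ≤ n → lagrange n (suc k) ≈ ∑ (suc (n ∸ suc k)) (λ j → pot (+ suc k) j * lagrange (n ∸ suc k) j)
  lagrange-recursion′ k n 1+k≤n =
    trans (reflexive (P.cong (λ t → lagrange t (suc k)) (P.sym (ℕ.m+[n∸m]≡n 1+k≤n)))) (lagrange-recursion k (n ∸ suc k))

  -- Since τ = shift (g ∘ τ), the coefficients of τ^{k+1} are those of (g^{k+1} ∘ τ) shifted by k+1,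
  -- and g^{k+1} ∘ τ only involves powers of τ at lower degree; this drives a strong induction on n.
  powˢ-τ : ∀ n k → powˢ τ k n ≈ lagrange n k
  powˢ-τ = <-rec (λ n → ∀ k → powˢ τ k n ≈ lagrange n k) step
    where
    step : ∀ n → (∀ {m} → m < n → ∀ k → powˢ τ k m ≈ lagrange m k) → ∀ k → powˢ τ k n ≈ lagrange n k
    step zero    ih zero    = refl
    step (suc n) ih zero    = sym (trans (*-cong refl (trans (*-cong refl (zeroˡ _)) (zeroʳ _))) (zeroʳ _))
    step zero    ih (suc k) = powˢ-vanish τ refl (suc k) 0 (s≤s z≤n)
    step (suc n) ih (suc k) with suc k ℕ.≤? suc n
    ... | no  k≰n = trans (powˢ-vanish τ refl (suc k) (suc n) (ℕ.≰⇒> k≰n)) (sym (zeroˡ _))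
    ... | yes k≤n = begin
      powˢ τ (suc k) N                                  ≈⟨ powˢ-cong≤ N (suc k) τ≈shift[g∘τ] N ℕ.≤-refl ⟩
      powˢ (shift φ) (suc k) N                          ≈⟨ powˢ-shift φ (suc k) N ⟩
      shiftⁿ (suc k) (powˢ φ (suc k)) N                 ≈⟨ shiftⁿ-apply (suc k) (powˢ φ (suc k)) N k≤n ⟩
      powˢ φ (suc k) (N ∸ suc k)                        ≈⟨ sym (comp-powˢ τ refl g (suc k) (N ∸ suc k)) ⟩
      ∑ (suc (N ∸ suc k)) (λ j → powˢ g (suc k) j * powˢ τ j (N ∸ suc k))
        ≈⟨ ∑-cong (suc (N ∸ suc k)) (λ j → *-cong (powˢ-g (suc k) j) (ih (s≤s (ℕ.m∸n≤m n k)) j)) ⟩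
      ∑ (suc (N ∸ suc k)) (λ j → pot (+ suc k) j * lagrange (N ∸ suc k) j)
        ≈⟨ sym (lagrange-recursion′ k N k≤n) ⟩
      lagrange N (suc k)                                ≈⟨ *-cong (𝟙-yes (suc k ℕ.≤? N) k≤n) refl ⟩
      𝟙 (yes k≤n) * (ι⁻¹ N * (ι (suc k) * pot (+ N) (N ∸ suc k))) ∎
      where
      N = suc n
      φ = comp g τ
      τ≈shift[g∘τ] : ∀ i → i ≤ N → τ i ≈ shift φ i
      τ≈shift[g∘τ] zero    _         = refl
      τ≈shift[g∘τ] (suc i) (s≤s i≤n) = begin
        τ (suc i)                                 ≈⟨ τ-suc i ⟩
        ι⁻¹ (suc i) * pot (+ suc i) i             ≈⟨ sym (trans (lagrange-k≤n i 1 (s≤s z≤n)) (*-cong refl (trans (*-cong ι1≈1 refl) (*-identityˡ _)))) ⟩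
        lagrange (suc i) 1                        ≈⟨ lagrange-recursion 0 i ⟩
        ∑ (suc i) (λ j → pot (+ 1) j * lagrange i j) ≈⟨ ∑-cong (suc i) (λ j → *-cong (pot-1 j) (sym (ih (s≤s i≤n) j))) ⟩
        φ i                                       ∎

  Bell[T̂]≈lagrange : ∀ n k → Bell n k (Tsub x) ≈ ι (n !) * (ι⁻¹ (k !) * lagrange n k)
  Bell[T̂]≈lagrange n k = trans (Bell≈dpow n k (Tsub x)) (*-cong refl (*-cong refl (powˢ-τ n k)))


module TriangularSystems {c ℓ : Level} (F : Char0Field c ℓ) where

  open import Data.Nat as ℕ using (ℕ; suc; _∸_; _≤_; z≤n; s≤s; _≡ᵇ_)
  import Data.Nat.Properties as ℕ
  open import Data.Bool using (true; false; T)
  open import Data.Empty using (⊥-elim)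
  open import Relation.Binary.PropositionalEquality as P using (_≡_)
  open BellPolynomials F

  δ-refl : ∀ n → δ n n ≈ 1#
  δ-refl n with n ≡ᵇ n in eq
  ... | true  = refl
  ... | false = ⊥-elim (P.subst T eq (ℕ.≡⇒≡ᵇ n n P.refl))

  δ-≢ : ∀ n k → ¬ (n ≡ k) → δ n k ≈ 0#
  δ-≢ n k n≢k with n ≡ᵇ k in eq
  ... | true  = ⊥-elim (n≢k (ℕ.≡ᵇ⇒≡ n k (P.subst T (P.sym eq) _)))
  ... | false = refl

  ∑-triangle-product : ∀ (a : ℕ → Carrier) (B : ℕ → ℕ → Carrier) (c : ℕ → Carrier) d →
    ∑ (suc d) (λ t → a t * ∑ (suc t) (λ u → B t u * c u)) ≈ ∑ (suc d) (λ u → ∑ (suc (d ∸ u)) (λ v → a (u ℕ.+ v) * B (u ℕ.+ v) u) * c u)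
  ∑-triangle-product a B c d = begin
    ∑ (suc d) (λ t → a t * ∑ (suc t) (λ u → B t u * c u))
      ≈⟨ ∑-cong (suc d) (λ t → trans (∑-*ˡ (suc t) (a t) _) (∑-cong< (suc t) (λ u u≤t → reindex t u (ℕ.≤-pred u≤t)))) ⟩
    ∑ (suc d) (λ t → ∑ (suc t) (λ u → G u (t ∸ u)))
      ≈⟨ ∑-triangle d G ⟩
    ∑ (suc d) (λ u → ∑ (suc (d ∸ u)) (G u))
      ≈⟨ ∑-cong (suc d) (λ u → sym (∑-*ʳ (suc (d ∸ u)) (c u) _)) ⟩
    ∑ (suc d) (λ u → ∑ (suc (d ∸ u)) (λ v → a (u ℕ.+ v) * B (u ℕ.+ v) u) * c u) ∎
    where
    G : ℕ → ℕ → Carrier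
    G u v = a (u ℕ.+ v) * B (u ℕ.+ v) u * c u
    reindex : ∀ t u → u ≤ t → a t * (B t u * c u) ≈ G u (t ∸ u)
    reindex t u u≤t = trans (sym (*-assoc _ _ _)) (reflexive (P.cong (λ z → a z * B z u * c u) (P.sym (ℕ.m+[n∸m]≡n u≤t))))

  -- a = a (B c) = (a B) c = c, where every matrix product is a sum over a triangle of indices.
  left-inverse-column : ∀ (a B : ℕ → ℕ → Carrier) (c : ℕ → Carrier) K →
    (∀ n k → k ≤ n → sumFromTo k n (λ j → a n j * B j k) ≈ δ n k) →
    (∀ m → sumFromTo K (K ℕ.+ m) (λ l → B (K ℕ.+ m) l * c l) ≈ δ (K ℕ.+ m) K) →
    ∀ d → a (K ℕ.+ d) K ≈ c (K ℕ.+ d)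
  left-inverse-column a B c K aB≈I Bc≈e d = begin
    a n K
      ≈⟨ sym pick-a ⟩
    ∑ (suc d) (λ t → a n (K ℕ.+ t) * δ (K ℕ.+ t) K)
      ≈⟨ ∑-cong (suc d) (λ t → *-cong refl (sym (trans (sym (sumFromTo[a,a+t]≈∑ K t (λ l → B (K ℕ.+ t) l * c l))) (Bc≈e t)))) ⟩
    ∑ (suc d) (λ t → a n (K ℕ.+ t) * ∑ (suc t) (λ u → B (K ℕ.+ t) (K ℕ.+ u) * c (K ℕ.+ u)))
      ≈⟨ ∑-triangle-product (λ t → a n (K ℕ.+ t)) (λ t u → B (K ℕ.+ t) (K ℕ.+ u)) (λ u → c (K ℕ.+ u)) d ⟩
    ∑ (suc d) (λ u → ∑ (suc (d ∸ u)) (λ v → a n (K ℕ.+ (u ℕ.+ v)) * B (K ℕ.+ (u ℕ.+ v)) (K ℕ.+ u)) * c (K ℕ.+ u))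
      ≈⟨ ∑-cong< (suc d) (λ u u≤d → *-cong (row≈δ u (ℕ.≤-pred u≤d)) refl) ⟩
    ∑ (suc d) (λ u → δ n (K ℕ.+ u) * c (K ℕ.+ u))
      ≈⟨ ∑-single (suc d) d _ ℕ.≤-refl (λ u _ u≢d → trans (*-cong (δ-≢ n (K ℕ.+ u) (λ n≡K+u → u≢d (P.sym (ℕ.+-cancelˡ-≡ K d u n≡K+u)))) refl) (zeroˡ _)) ⟩
    δ n (K ℕ.+ d) * c (K ℕ.+ d)
      ≈⟨ trans (*-cong (δ-refl n) refl) (*-identityˡ _) ⟩
    c n ∎
    where
    n = K ℕ.+ d
    pick-a : ∑ (suc d) (λ t → a n (K ℕ.+ t) * δ (K ℕ.+ t) K) ≈ a n K
    pick-a = begin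
      ∑ (suc d) (λ t → a n (K ℕ.+ t) * δ (K ℕ.+ t) K)
        ≈⟨ ∑-single (suc d) 0 _ (s≤s z≤n) (λ t _ t≢0 → trans (*-cong refl (δ-≢ (K ℕ.+ t) K (K+t≢K t≢0))) (zeroʳ _)) ⟩
      a n (K ℕ.+ 0) * δ (K ℕ.+ 0) K
        ≈⟨ reflexive (P.cong (λ t → a n t * δ t K) (ℕ.+-identityʳ K)) ⟩
      a n K * δ K K
        ≈⟨ trans (*-cong refl (δ-refl K)) (*-identityʳ _) ⟩
      a n K ∎
      where
      K+t≢K : ∀ {t} → ¬ (t ≡ 0) → ¬ (K ℕ.+ t ≡ K)
      K+t≢K {t} t≢0 K+t≡K = t≢0 (ℕ.+-cancelˡ-≡ K t 0 (P.trans K+t≡K (P.sym (ℕ.+-identityʳ K))))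
    row≈δ : ∀ u → u ≤ d → ∑ (suc (d ∸ u)) (λ v → a n (K ℕ.+ (u ℕ.+ v)) * B (K ℕ.+ (u ℕ.+ v)) (K ℕ.+ u)) ≈ δ n (K ℕ.+ u)
    row≈δ u u≤d = begin
      ∑ (suc (d ∸ u)) (λ v → a n (K ℕ.+ (u ℕ.+ v)) * B (K ℕ.+ (u ℕ.+ v)) (K ℕ.+ u))
        ≈⟨ ∑-cong (suc (d ∸ u)) (λ v → reflexive (P.cong (λ j → a n j * B j (K ℕ.+ u)) (P.sym (ℕ.+-assoc K u v)))) ⟩
      ∑ (suc (d ∸ u)) (λ v → a n (K ℕ.+ u ℕ.+ v) * B (K ℕ.+ u ℕ.+ v) (K ℕ.+ u))
        ≈⟨ sym (trans (sumFromTo≈∑ (K ℕ.+ u) n (λ j → a n j * B j (K ℕ.+ u))) (∑-≡ _ [1+n]∸[K+u]≡)) ⟩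
      sumFromTo (K ℕ.+ u) n (λ j → a n j * B j (K ℕ.+ u))
        ≈⟨ aB≈I n (K ℕ.+ u) (ℕ.+-monoʳ-≤ K u≤d) ⟩
      δ n (K ℕ.+ u) ∎
      where
      [1+n]∸[K+u]≡ : suc n ∸ (K ℕ.+ u) ≡ suc (d ∸ u)
      [1+n]∸[K+u]≡ = P.trans (P.cong (_∸ (K ℕ.+ u)) (P.sym (ℕ.+-suc K d))) (P.trans (ℕ.[m+n]∸[m+o]≡n∸o K (suc d) u) (ℕ.+-∸-assoc 1 u≤d))

module BellInverse {c ℓ : Level} (F : Char0Field c ℓ) (x : ℕ → Char0Field.Carrier F) (k : ℕ) where

  open import Data.Nat as ℕ using (ℕ; zero; suc; _∸_; _<_; _!)
  import Data.Nat.Properties as ℕ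
  open import Data.Integer as ℤ using (+_; -[1+_])
  import Data.Integer.Properties as ℤ
  open import Relation.Binary.PropositionalEquality as P using (_≡_)
  open TreeFunction F x
  open TriangularSystems F using (δ-refl; δ-≢)

  K : ℕ
  K = suc k

  candidate : ℕ → Carrier
  candidate l = ι (l C K) * Phat (l ∸ K) (ℤ.- (+ K)) x

  candidate-K+u : ∀ u → candidate (K ℕ.+ u) ≈ (ι ((K ℕ.+ u) !) * ι⁻¹ (K !)) * pot (ℤ.- (+ K)) u
  candidate-K+u u = begin
    ι ((K ℕ.+ u) C K) * Phat (K ℕ.+ u ∸ K) (ℤ.- (+ K)) x
      ≈⟨ *-cong refl (Phat≈pot (K ℕ.+ u ∸ K) (ℤ.- (+ K))) ⟩
    ι ((K ℕ.+ u) C K) * (ι ((K ℕ.+ u ∸ K) !) * pot (ℤ.- (+ K)) (K ℕ.+ u ∸ K))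
      ≈⟨ sym (*-assoc _ _ _) ⟩
    (ι ((K ℕ.+ u) C K) * ι ((K ℕ.+ u ∸ K) !)) * pot (ℤ.- (+ K)) (K ℕ.+ u ∸ K)
      ≈⟨ *-cong (ι[nCk]*ι[[n∸k]!]≈ι[n!]*ι⁻¹[k!] (ℕ.m≤m+n K u)) refl ⟩
    (ι ((K ℕ.+ u) !) * ι⁻¹ (K !)) * pot (ℤ.- (+ K)) (K ℕ.+ u ∸ K)
      ≈⟨ *-cong refl (reflexive (P.cong (pot (ℤ.- (+ K))) (ℕ.m+n∸m≡n K u))) ⟩
    (ι ((K ℕ.+ u) !) * ι⁻¹ (K !)) * pot (ℤ.- (+ K)) u ∎

  column-sum : ∀ m → sumFromTo K (K ℕ.+ m) (λ l → Bell (K ℕ.+ m) l (Tsub x) * candidate l)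
                     ≈ (ι ((K ℕ.+ m) !) * ι⁻¹ (K !)) * ∑ (suc m) (λ u → lagrange (K ℕ.+ m) (K ℕ.+ u) * pot (ℤ.- (+ K)) u)
  column-sum m = begin
    sumFromTo K (K ℕ.+ m) (λ l → Bell n l (Tsub x) * candidate l)
      ≈⟨ sumFromTo[a,a+t]≈∑ K m (λ l → Bell n l (Tsub x) * candidate l) ⟩
    ∑ (suc m) (λ u → Bell n (K ℕ.+ u) (Tsub x) * candidate (K ℕ.+ u))
      ≈⟨ ∑-cong (suc m) term ⟩
    ∑ (suc m) (λ u → (ι (n !) * ι⁻¹ (K !)) * (lagrange n (K ℕ.+ u) * pot (ℤ.- (+ K)) u))
      ≈⟨ sym (∑-*ˡ (suc m) _ _) ⟩
    (ι (n !) * ι⁻¹ (K !)) * ∑ (suc m) (λ u → lagrange n (K ℕ.+ u) * pot (ℤ.- (+ K)) u) ∎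
    where
    n = K ℕ.+ m
    term : ∀ u → Bell n (K ℕ.+ u) (Tsub x) * candidate (K ℕ.+ u) ≈ (ι (n !) * ι⁻¹ (K !)) * (lagrange n (K ℕ.+ u) * pot (ℤ.- (+ K)) u)
    term u = begin
      Bell n l (Tsub x) * candidate l
        ≈⟨ *-cong (Bell[T̂]≈lagrange n l) (candidate-K+u u) ⟩
      (ι (n !) * (ι⁻¹ (l !) * lagrange n l)) * ((ι (l !) * ι⁻¹ (K !)) * pot (ℤ.- (+ K)) u)
        ≈⟨ zsolve 6 (λ a b r c d p → ((a :* (b :* r)) :* ((c :* d) :* p)) := ((c :* b) :* ((a :* d) :* (r :* p))))
             refl (ι (n !)) (ι⁻¹ (l !)) (lagrange n l) (ι (l !)) (ι⁻¹ (K !)) (pot (ℤ.- (+ K)) u) ⟩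
      (ι (l !) * ι⁻¹ (l !)) * ((ι (n !) * ι⁻¹ (K !)) * (lagrange n l * pot (ℤ.- (+ K)) u))
        ≈⟨ trans (*-cong (ι[n!]*ι⁻¹[n!] l) refl) (*-identityˡ _) ⟩
      (ι (n !) * ι⁻¹ (K !)) * (lagrange n l * pot (ℤ.- (+ K)) u) ∎
      where l = K ℕ.+ u

  module _ (x₀≉0 : ¬ (x₀ ≈ 0#)) where

    lagrange*pot-diagonal : lagrange K K * pot (ℤ.- (+ K)) 0 ≈ 1#
    lagrange*pot-diagonal = begin
      lagrange K K * pot (ℤ.- (+ K)) 0                 ≈⟨ *-cong (lagrange-diagonal k) refl ⟩
      pot (+ K) 0 * pot (ℤ.- (+ K)) 0                  ≈⟨ sym (∑-one (λ i → pot (+ K) i * pot (ℤ.- (+ K)) (0 ∸ i))) ⟩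
      conv (pot (+ K)) (pot (ℤ.- (+ K))) 0             ≈⟨ pot-+ x₀≉0 (+ K) (ℤ.- (+ K)) 0 ⟩
      pot (+ K ℤ.+ ℤ.- (+ K)) 0                        ≈⟨ pot-≡ (ℤ.+-inverseʳ (+ K)) 0 ⟩
      pot (+ 0) 0                                      ≈⟨ pot-0 0 ⟩
      1#                                               ∎

    private
      -K+[K+M]≡M : ∀ M → ℤ.- (+ K) ℤ.+ + (K ℕ.+ M) ≡ + M
      -K+[K+M]≡M M = P.trans (ℤ.-m+n≡n⊖m K (K ℕ.+ M)) (P.trans (ℤ.⊖-≥ (ℕ.m≤m+n K M)) (P.cong +_ (ℕ.m+n∸m≡n K M)))

    conv-θ[pot-K]-pot : ∀ m′ → conv (θ (pot (ℤ.- (+ K)))) (pot (+ (K ℕ.+ suc m′))) (suc m′) ≈ (- ι K) * pot (+ suc m′) (suc m′)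
    conv-θ[pot-K]-pot m′ = *-cancelˡ (char0 m′) (begin
      ι M * conv (θ (pot (ℤ.- (+ K)))) (pot (+ n)) M
        ≈⟨ *-cong (reflexive (P.cong ιℤ (P.sym (-K+[K+M]≡M M)))) refl ⟩
      ιℤ (ℤ.- (+ K) ℤ.+ + n) * conv (θ (pot (ℤ.- (+ K)))) (pot (+ n)) M
        ≈⟨ abel -[1+ K ] (+ n) (pot-+ x₀≉0 -[1+ K ] (+ n)) M ⟩
      (- ι K) * (ι M * pot (ℤ.- (+ K) ℤ.+ + n) M)
        ≈⟨ *-cong refl (*-cong refl (pot-≡ (-K+[K+M]≡M M) M)) ⟩
      (- ι K) * (ι M * pot (+ M) M)
        ≈⟨ zsolve 3 (λ a b p → ((:- a) :* (b :* p)) := (b :* ((:- a) :* p))) refl (ι K) (ι M) (pot (+ M) M) ⟩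
      ι M * ((- ι K) * pot (+ M) M) ∎)
      where
      M = suc m′
      n = K ℕ.+ M

    -- With n = K + M, the weight (K+u)/n of lagrange n (K+u) splits into K/n and u/n; the u/n part
    -- is the coefficient of θ(g^{-K}) gⁿ, which Abel's identity evaluates to -K/n · [t^M] g^M.
    lagrange*pot-off-diagonal : ∀ m′ → ∑ (suc (suc m′)) (λ u → lagrange (K ℕ.+ suc m′) (K ℕ.+ u) * pot (ℤ.- (+ K)) u) ≈ 0#
    lagrange*pot-off-diagonal m′ = begin
      ∑ (suc M) (λ u → lagrange n (K ℕ.+ u) * pot (ℤ.- (+ K)) u)
        ≈⟨ ∑-cong< (suc M) split ⟩
      ∑ (suc M) (λ u → ι⁻¹ n * (ι K * (pot (ℤ.- (+ K)) u * pot (+ n) (M ∸ u)) + θ (pot (ℤ.- (+ K))) u * pot (+ n) (M ∸ u)))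
        ≈⟨ trans (sym (∑-*ˡ (suc M) (ι⁻¹ n) _)) (*-cong refl (∑-+ (suc M) _ _)) ⟩
      ι⁻¹ n * (∑ (suc M) (λ u → ι K * (pot (ℤ.- (+ K)) u * pot (+ n) (M ∸ u))) + conv (θ (pot (ℤ.- (+ K)))) (pot (+ n)) M)
        ≈⟨ *-cong refl (+-cong (trans (sym (∑-*ˡ (suc M) (ι K) _)) (*-cong refl (trans (pot-+ x₀≉0 (ℤ.- (+ K)) (+ n) M) (pot-≡ (-K+[K+M]≡M M) M))))
                               (conv-θ[pot-K]-pot m′)) ⟩
      ι⁻¹ n * (ι K * pot (+ M) M + (- ι K) * pot (+ M) M)
        ≈⟨ zsolve 3 (λ a b p → (a :* ((b :* p) :+ ((:- b) :* p))) := con (+ 0)) refl (ι⁻¹ n) (ι K) (pot (+ M) M) ⟩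
      0# ∎
      where
      M = suc m′
      n = K ℕ.+ M
      split : ∀ u → u < suc M → lagrange n (K ℕ.+ u) * pot (ℤ.- (+ K)) u
                                ≈ ι⁻¹ n * (ι K * (pot (ℤ.- (+ K)) u * pot (+ n) (M ∸ u)) + θ (pot (ℤ.- (+ K))) u * pot (+ n) (M ∸ u))
      split u u≤M = begin
        lagrange n (K ℕ.+ u) * pot (ℤ.- (+ K)) u
          ≈⟨ *-cong (lagrange-k≤n (k ℕ.+ M) (K ℕ.+ u) (ℕ.+-monoʳ-≤ K (ℕ.≤-pred u≤M))) refl ⟩
        (ι⁻¹ n * (ι (K ℕ.+ u) * pot (+ n) (n ∸ (K ℕ.+ u)))) * pot (ℤ.- (+ K)) u
          ≈⟨ *-cong (*-cong refl (*-cong (ι-+ K u) (reflexive (P.cong (pot (+ n)) (ℕ.[m+n]∸[m+o]≡n∸o K M u))))) refl ⟩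
        (ι⁻¹ n * ((ι K + ι u) * pot (+ n) (M ∸ u))) * pot (ℤ.- (+ K)) u
          ≈⟨ zsolve 5 (λ v a b p q → ((v :* ((a :+ b) :* p)) :* q) := (v :* ((a :* (q :* p)) :+ ((b :* q) :* p))))
                     refl (ι⁻¹ n) (ι K) (ι u) (pot (+ n) (M ∸ u)) (pot (ℤ.- (+ K)) u) ⟩
        ι⁻¹ n * (ι K * (pot (ℤ.- (+ K)) u * pot (+ n) (M ∸ u)) + θ (pot (ℤ.- (+ K))) u * pot (+ n) (M ∸ u)) ∎

    Bell*candidate≈δ : ∀ m → sumFromTo K (K ℕ.+ m) (λ l → Bell (K ℕ.+ m) l (Tsub x) * candidate l) ≈ δ (K ℕ.+ m) K
    Bell*candidate≈δ zero = begin
      sumFromTo K (K ℕ.+ 0) (λ l → Bell (K ℕ.+ 0) l (Tsub x) * candidate l)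
        ≈⟨ column-sum 0 ⟩
      (ι ((K ℕ.+ 0) !) * ι⁻¹ (K !)) * ∑ 1 (λ u → lagrange (K ℕ.+ 0) (K ℕ.+ u) * pot (ℤ.- (+ K)) u)
        ≈⟨ *-cong refl (∑-one _) ⟩
      (ι ((K ℕ.+ 0) !) * ι⁻¹ (K !)) * (lagrange (K ℕ.+ 0) (K ℕ.+ 0) * pot (ℤ.- (+ K)) 0)
        ≈⟨ reflexive (P.cong (λ t → (ι (t !) * ι⁻¹ (K !)) * (lagrange t t * pot (ℤ.- (+ K)) 0)) (ℕ.+-identityʳ K)) ⟩
      (ι (K !) * ι⁻¹ (K !)) * (lagrange K K * pot (ℤ.- (+ K)) 0)
        ≈⟨ trans (*-cong (ι[n!]*ι⁻¹[n!] K) lagrange*pot-diagonal) (*-identityˡ _) ⟩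
      1#
        ≈⟨ sym (trans (reflexive (P.cong (λ t → δ t K) (ℕ.+-identityʳ K))) (δ-refl K)) ⟩
      δ (K ℕ.+ 0) K ∎
    Bell*candidate≈δ (suc m′) = begin
      sumFromTo K (K ℕ.+ suc m′) (λ l → Bell (K ℕ.+ suc m′) l (Tsub x) * candidate l)
        ≈⟨ column-sum (suc m′) ⟩
      (ι ((K ℕ.+ suc m′) !) * ι⁻¹ (K !)) * ∑ (suc (suc m′)) (λ u → lagrange (K ℕ.+ suc m′) (K ℕ.+ u) * pot (ℤ.- (+ K)) u)
        ≈⟨ trans (*-cong refl (lagrange*pot-off-diagonal m′)) (zeroʳ _) ⟩
      0#
        ≈⟨ sym (δ-≢ (K ℕ.+ suc m′) K K+1+m′≢K) ⟩
      δ (K ℕ.+ suc m′) K ∎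
      where
      K+1+m′≢K : ¬ (K ℕ.+ suc m′ ≡ K)
      K+1+m′≢K K+1+m′≡K with ℕ.+-cancelˡ-≡ K (suc m′) 0 (P.trans K+1+m′≡K (P.sym (ℕ.+-identityʳ K)))
      ... | ()


module Theorem {c ℓ : Level} (F : Char0Field c ℓ) where

  open import Data.Nat as ℕ using (ℕ; suc; _!; z≤n; s≤s)
  import Data.Nat.Properties as ℕ
  open import Relation.Binary.PropositionalEquality as P using (_≡_)
  open BellPolynomials F
  open TriangularSystems F using (left-inverse-column)

  part-i : ∀ (n k : ℕ) → 1 ≤ k → k ≤ n → ∀ (x : Val) →
    Bell n k (Tsub x) ≈ ι ((n ∸ 1) C (k ∸ 1)) * Phat (n ∸ k) (+ n) x
  part-i (suc n) (suc k) (s≤s z≤n) (s≤s k≤n) x = begin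
    Bell (suc n) (suc k) (Tsub x)
      ≈⟨ Bell[T̂]≈lagrange (suc n) (suc k) ⟩
    ι (suc n !) * (ι⁻¹ (suc k !) * lagrange (suc n) (suc k))
      ≈⟨ *-cong refl (*-cong refl (lagrange-k≤n n (suc k) (s≤s k≤n))) ⟩
    ι (suc n !) * (ι⁻¹ (suc k !) * (ι⁻¹ (suc n) * (ι (suc k) * H)))
      ≈⟨ zsolve 5 (λ a b c d p → (a :* (b :* (c :* (d :* p)))) := ((a :* (b :* (c :* d))) :* p))
           refl (ι (suc n !)) (ι⁻¹ (suc k !)) (ι⁻¹ (suc n)) (ι (suc k)) H ⟩
    (ι (suc n !) * (ι⁻¹ (suc k !) * (ι⁻¹ (suc n) * ι (suc k)))) * H
      ≈⟨ *-cong coefficient refl ⟩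
    (ι (n C k) * ι ((n ∸ k) !)) * H
      ≈⟨ trans (*-assoc _ _ _) (*-cong refl (sym (Phat≈pot (n ∸ k) (+ suc n)))) ⟩
    ι (n C k) * Phat (n ∸ k) (+ suc n) x ∎
    where
    open TreeFunction F x using (Bell[T̂]≈lagrange; lagrange; lagrange-k≤n; pot; Phat≈pot)
    H = pot (+ suc n) (n ∸ k)
    coefficient : ι (suc n !) * (ι⁻¹ (suc k !) * (ι⁻¹ (suc n) * ι (suc k))) ≈ ι (n C k) * ι ((n ∸ k) !)
    coefficient = begin
      ι (suc n !) * (ι⁻¹ (suc k !) * (ι⁻¹ (suc n) * ι (suc k)))
        ≈⟨ *-cong (ι-* (suc n) (n !)) (*-cong (ι⁻¹[suc-n!] k) refl) ⟩
      (ι (suc n) * ι (n !)) * ((ι⁻¹ (suc k) * ι⁻¹ (k !)) * (ι⁻¹ (suc n) * ι (suc k)))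
        ≈⟨ zsolve 6 (λ a b c d e f → ((a :* b) :* ((c :* d) :* (e :* f))) := (((a :* e) :* (f :* c)) :* (b :* d)))
             refl (ι (suc n)) (ι (n !)) (ι⁻¹ (suc k)) (ι⁻¹ (k !)) (ι⁻¹ (suc n)) (ι (suc k)) ⟩
      ((ι (suc n) * ι⁻¹ (suc n)) * (ι (suc k) * ι⁻¹ (suc k))) * (ι (n !) * ι⁻¹ (k !))
        ≈⟨ trans (*-cong (trans (*-cong (ι*ι⁻¹ (suc n)) (ι*ι⁻¹ (suc k))) (*-identityˡ _)) refl) (*-identityˡ _) ⟩
      ι (n !) * ι⁻¹ (k !)
        ≈⟨ sym (ι[nCk]*ι[[n∸k]!]≈ι[n!]*ι⁻¹[k!] k≤n) ⟩
      ι (n C k) * ι ((n ∸ k) !) ∎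

  part-ii : ∀ (n k : ℕ) → 1 ≤ k → k ≤ n → ∀ (x : Val) → ¬ (x 0 ≈ 0#) →
    ∀ (a : ℕ → ℕ → Carrier) → IsBellInverse a (Tsub x) →
    a n k ≈ ι (n C k) * Phat (n ∸ k) (ℤ.- (+ k)) x
  part-ii n (suc k) _ K≤n x x₀≉0 a (_ , _ , _ , aB≈I) = begin
    a n K                         ≈⟨ reflexive (P.cong (λ t → a t K) (P.sym K+[n∸K]≡n)) ⟩
    a (K ℕ.+ (n ∸ K)) K
      ≈⟨ left-inverse-column a (λ j l → Bell j l (Tsub x)) candidate K aB≈I (Bell*candidate≈δ x₀≉0) (n ∸ K) ⟩
    candidate (K ℕ.+ (n ∸ K))     ≈⟨ reflexive (P.cong candidate K+[n∸K]≡n) ⟩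
    candidate n                   ∎
    where
    open BellInverse F x k using (K; candidate; Bell*candidate≈δ)
    K+[n∸K]≡n : K ℕ.+ (n ∸ K) ≡ n
    K+[n∸K]≡n = ℕ.m+[n∸m]≡n K≤n


theorem5p11 : ∀ {c ℓ : Level} (F : Char0Field c ℓ) →
    let open Polys F in
    (∀ (n k : ℕ) → 1 ≤ k → k ≤ n → ∀ (x : Val) →
       Bell n k (Tsub x) ≈ ι ((n ∸ 1) C (k ∸ 1)) * Phat (n ∸ k) (+ n) x)
    ×
    (∀ (n k : ℕ) → 1 ≤ k → k ≤ n → ∀ (x : Val) → ¬ (x 0 ≈ 0#) →
       ∀ (a : ℕ → ℕ → Carrier) → IsBellInverse a (Tsub x) →
       a n k ≈ ι (n C k) * Phat (n ∸ k) (ℤ.- (+ k)) x)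
theorem5p11 F = Theorem.part-i F , Theorem.part-ii F
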